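{- The graph $R_{15}$ is Class 0, i.e. $\pi(R_{15})=15$.
   Context: $R_{15}$ is the graph on vertices $v_1,\dots,v_{15}$ whose adjacency lists (neighbors of $v_1,v_2,\dots,v_{15}$ in order, given by indices) are: $v_1$: 2,4,5,6,12,13; $v_2$: 1,3,4,8,11,12,14; $v_3$: 2,4,6,7; $v_4$: 1,2,3,5,7,9,14; $v_5$: 1,4,6,8,11,15; $v_6$: 1,3,5,9,13,14; $v_7$: 3,4,11,15; $v_8$: 2,5,10,13,14,15; $v_9$: 4,6,10,11; $v_{10}$: 8,9,11; $v_{11}$: 2,5,7,9,10,12,15; $v_{12}$: 1,2,11,13; $v_{13}$: 1,6,8,12; $v_{14}$: 2,4,6,8; $v_{15}$: 5,7,8,11. A configuration on a connected graph $G$ is a function $C:V(G)\to\mathbb{N}$; a pebbling step from $u$ to a neighbor $v$ removes two pebbles from $u$ and adds one to $v$; $C$ is $r$-solvable if some sequence of pebbling steps places a pebble on $r$. $\pi(G,r)$ is the minimum $t$ such that every configuration with $t$ pebbles in total is $r$-solvable, $\pi(G)=\max_r\pi(G,r)$, and $G$ is Class 0 if $\pi(G)=|V(G)|$. -}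

module Defs where

open import Data.Nat using (ℕ; zero; suc; _+_; _∸_; _≤_; _<_)
open import Data.Fin using (Fin; toℕ; _≟_) renaming (zero to fzero; suc to fsuc)
open import Relation.Binary.PropositionalEquality using (_≡_)
open import Data.List using (List; []; _∷_)
open import Data.List.Membership.Propositional using (_∈_)
open import Data.Product using (Σ; _×_; ∃; ∃-syntax)
open import Relation.Nullary using (¬_; yes; no)
open import Relation.Binary.Construct.Closure.ReflexiveTransitive using (Star)

record Graph : Set₁ where
  field
    n   : ℕ
    Adj : Fin n → Fin n → Set
open Graph public

Config : Graph → Set
Config G = Fin (n G) → ℕ

∑ : ∀ {m} → (Fin m → ℕ) → ℕ
∑ {zero}  f = 0
∑ {suc m} f = f fzero + ∑ (λ i → f (fsuc i))

size : (G : Graph) → Config G → ℕ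
size G C = ∑ C

move : ∀ {m} → (Fin m → ℕ) → Fin m → Fin m → (Fin m → ℕ)
move C u v w with w ≟ u | w ≟ v
... | yes _ | _     = C w ∸ 2
... | no _  | yes _ = C w + 1
... | no _  | no _  = C w

data Step (G : Graph) : Config G → Config G → Set where
  step : ∀ {C} (u v : Fin (n G)) → Adj G u v → 2 ≤ C u → Step G C (move C u v)

Reach : (G : Graph) → Config G → Config G → Set
Reach G = Star (Step G)

Solvable : (G : Graph) → Config G → Fin (n G) → Set
Solvable G C r = ∃[ D ] (Reach G C D × 1 ≤ D r)

AllSolvable : (G : Graph) → Fin (n G) → ℕ → Set
AllSolvable G r t = ∀ (C : Config G) → size G C ≡ t → Solvable G C r

IsRootedPebblingNumber : (G : Graph) → Fin (n G) → ℕ → Set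
IsRootedPebblingNumber G r t = AllSolvable G r t × (∀ s → AllSolvable G r s → t ≤ s)

IsPebblingNumber : (G : Graph) → ℕ → Set
IsPebblingNumber G t =
  (∀ r → ∃[ s ] (IsRootedPebblingNumber G r s × s ≤ t))
  × (∃[ r ] IsRootedPebblingNumber G r t)

Class0 : Graph → Set
Class0 G = IsPebblingNumber G (n G)

-- R₁₅: neighbours of v_i (1-based labels, as in the paper)
R15-nbrs : Fin 15 → List ℕ
R15-nbrs i = go (toℕ i)
  where
  go : ℕ → List ℕ
  go 0  = 2 ∷ 4 ∷ 5 ∷ 6 ∷ 12 ∷ 13 ∷ []
  go 1  = 1 ∷ 3 ∷ 4 ∷ 8 ∷ 11 ∷ 12 ∷ 14 ∷ []
  go 2  = 2 ∷ 4 ∷ 6 ∷ 7 ∷ []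
  go 3  = 1 ∷ 2 ∷ 3 ∷ 5 ∷ 7 ∷ 9 ∷ 14 ∷ []
  go 4  = 1 ∷ 4 ∷ 6 ∷ 8 ∷ 11 ∷ 15 ∷ []
  go 5  = 1 ∷ 3 ∷ 5 ∷ 9 ∷ 13 ∷ 14 ∷ []
  go 6  = 3 ∷ 4 ∷ 11 ∷ 15 ∷ []
  go 7  = 2 ∷ 5 ∷ 10 ∷ 13 ∷ 14 ∷ 15 ∷ []
  go 8  = 4 ∷ 6 ∷ 10 ∷ 11 ∷ []
  go 9  = 8 ∷ 9 ∷ 11 ∷ []
  go 10 = 2 ∷ 5 ∷ 7 ∷ 9 ∷ 10 ∷ 12 ∷ 15 ∷ []
  go 11 = 1 ∷ 2 ∷ 11 ∷ 13 ∷ []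
  go 12 = 1 ∷ 6 ∷ 8 ∷ 12 ∷ []
  go 13 = 2 ∷ 4 ∷ 6 ∷ 8 ∷ []
  go 14 = 5 ∷ 7 ∷ 8 ∷ 11 ∷ []
  go _  = []

-- vertex Fin index i corresponds to v_{i+1}
R15 : Graph
R15 = record { n = 15 ; Adj = λ u v → suc (toℕ v) ∈ R15-nbrs u }

-- The lower bound π(G, r) ≥ |V(G)| holds in every graph: one pebble on each of fewer than |V(G)|
-- vertices other than r permits no move.  For the upper bound we use Hurlbert's weight function
-- lemma: if each vertex of positive weight has a neighbour that is r or carries at least twice its
-- weight, and w(r) = 0, then every r-unsolvable configuration C has ∑ w(x) C(x) ≤ ∑ w(x).  For each
-- root r, a nonnegative integer combination of such weight functions shows that no configuration of
-- 15 pebbles with r empty satisfies all these bounds.  For the root v₁₀ this needs a case split on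
-- the number of pebbles at single vertices, and a few of the resulting cases are solved by
-- explicit sequences of pebbling steps.

module Submission where

open import Defs
open import Data.Empty using (⊥; ⊥-elim)
open import Data.Fin using (Fin; toℕ; #_; _≟_) renaming (zero to fzero; suc to fsuc)
open import Data.Fin.Properties using (any?; all?)
open import Data.List using (List; []; _∷_)
open import Data.List.Relation.Unary.All as All using (All; []; _∷_)
open import Data.Nat using (ℕ; zero; suc; _+_; _*_; _∸_; _≤_; _<_; z≤n; s≤s; _≤?_; _<?_)
import Data.Nat as ℕ
open import Data.List.Membership.DecPropositional ℕ._≟_ using (_∈?_)
open import Data.Nat.DivMod using (_mod_)
open import Data.Nat.Induction using (<-wellFounded)
open import Data.Nat.Properties hiding (_≟_)
open import Algebra.Properties.CommutativeSemigroup +-commutativeSemigroup using (interchange)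
open import Data.Product using (_×_; _,_; proj₁; proj₂; ∃-syntax)
open import Data.Sum using (_⊎_; inj₁; inj₂)
open import Data.Unit using (⊤; tt)
open import Data.Vec using (Vec; []; _∷_)
import Data.Vec as Vec
open import Data.Vec.Functional using (updateAt)
import Data.Vec.Functional as Vector
open import Data.Vec.Functional.Properties using (updateAt-updates; updateAt-minimal)
open import Function using (_∘_)
open import Induction.WellFounded using (Acc; acc)
open import Relation.Binary.Construct.Closure.ReflexiveTransitive using (ε; _◅_)
open import Relation.Binary.PropositionalEquality
open import Relation.Nullary using (¬_; Dec; yes; no; ¬?)
open import Relation.Nullary.Decidable using (_×-dec_; _⊎-dec_; toWitness)

private
  variable
    m t : ℕ
    u v x : Fin m
    C D F : Fin m → ℕ

-- Sums and weighted sums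

∑-cong : {f g : Fin m → ℕ} → (∀ x → f x ≡ g x) → ∑ f ≡ ∑ g
∑-cong {zero}  f≗g = refl
∑-cong {suc m} f≗g = cong₂ _+_ (f≗g fzero) (∑-cong (f≗g ∘ fsuc))

∑-mono-≤ : {f g : Fin m → ℕ} → (∀ x → f x ≤ g x) → ∑ f ≤ ∑ g
∑-mono-≤ {zero}  f≤g = z≤n
∑-mono-≤ {suc m} f≤g = +-mono-≤ (f≤g fzero) (∑-mono-≤ (f≤g ∘ fsuc))

∑-zero : ∑ {m} (λ _ → 0) ≡ 0
∑-zero {zero}  = refl
∑-zero {suc m} = ∑-zero {m}

∑-distrib-+ : (f g : Fin m → ℕ) → ∑ (λ x → f x + g x) ≡ ∑ f + ∑ g
∑-distrib-+ {zero}  f g = refl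
∑-distrib-+ {suc m} f g = trans (cong (f fzero + g fzero +_) (∑-distrib-+ (f ∘ fsuc) (g ∘ fsuc)))
                                (interchange (f fzero) (g fzero) _ _)

∑-distribˡ-* : ∀ k (f : Fin m → ℕ) → ∑ (λ x → k * f x) ≡ k * ∑ f
∑-distribˡ-* {zero}  k f = sym (*-zeroʳ k)
∑-distribˡ-* {suc m} k f = trans (cong (k * f fzero +_) (∑-distribˡ-* k (f ∘ fsuc)))
                                 (sym (*-distribˡ-+ k (f fzero) _))

∑-distrib-∸ : {f g : Fin m → ℕ} → (∀ x → g x ≤ f x) → ∑ (λ x → f x ∸ g x) ≡ ∑ f ∸ ∑ g
∑-distrib-∸ {f = f} {g} g≤f = begin
  ∑ (λ x → f x ∸ g x)                 ≡⟨ m+n∸n≡m _ (∑ g) ⟨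
  ∑ (λ x → f x ∸ g x) + ∑ g ∸ ∑ g     ≡⟨ cong (_∸ ∑ g) (∑-distrib-+ (λ x → f x ∸ g x) g) ⟨
  ∑ (λ x → f x ∸ g x + g x) ∸ ∑ g     ≡⟨ cong (_∸ ∑ g) (∑-cong (m∸n+n≡m ∘ g≤f)) ⟩
  ∑ f ∸ ∑ g                           ∎
  where open ≡-Reasoning

point : Fin m → ℕ → Fin m → ℕ
point u a = updateAt (λ _ → 0) u (λ _ → a)

point-same : ∀ (u : Fin m) a → point u a u ≡ a
point-same u a = updateAt-updates u (λ _ → 0)

point-other : ∀ a → x ≢ u → point u a x ≡ 0
point-other {x = x} {u} a x≢u = updateAt-minimal x u (λ _ → 0) x≢u

∑-point : ∀ (u : Fin m) a → ∑ (point u a) ≡ a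
∑-point {suc m} fzero    a = trans (cong (a +_) (∑-zero {m})) (+-identityʳ a)
∑-point {suc m} (fsuc u) a = ∑-point u a

infix 7 _·_

_·_ : (Fin m → ℕ) → (Fin m → ℕ) → ℕ
w · C = ∑ λ x → w x * C x

ones : Fin m → ℕ
ones _ = 1

·-congʳ : ∀ (w : Fin m → ℕ) → (∀ x → C x ≡ D x) → w · C ≡ w · D
·-congʳ w C≗D = ∑-cong (λ x → cong (w x *_) (C≗D x))

·-distribʳ-+ : ∀ (w : Fin m → ℕ) C D → w · (λ x → C x + D x) ≡ w · C + w · D
·-distribʳ-+ w C D = trans (∑-cong (λ x → *-distribˡ-+ (w x) (C x) (D x)))
                           (∑-distrib-+ (λ x → w x * C x) (λ x → w x * D x))

·-linearˡ : ∀ k (w W C : Fin m → ℕ) → (λ x → k * w x + W x) · C ≡ k * (w · C) + W · C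
·-linearˡ k w W C = begin
  ∑ (λ x → (k * w x + W x) * C x)          ≡⟨ ∑-cong distribute ⟩
  ∑ (λ x → k * (w x * C x) + W x * C x)    ≡⟨ ∑-distrib-+ (λ x → k * (w x * C x)) (λ x → W x * C x) ⟩
  ∑ (λ x → k * (w x * C x)) + W · C        ≡⟨ cong (_+ W · C) (∑-distribˡ-* k (λ x → w x * C x)) ⟩
  k * (w · C) + W · C                      ∎
  where
  open ≡-Reasoning
  distribute : ∀ x → (k * w x + W x) * C x ≡ k * (w x * C x) + W x * C x
  distribute x = trans (*-distribʳ-+ (C x) (k * w x) (W x)) (cong (_+ W x * C x) (*-assoc k (w x) (C x)))

·-point : ∀ (w : Fin m → ℕ) u a → w · point u a ≡ w u * a
·-point w u a = trans (∑-cong pointwise) (∑-point u (w u * a))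
  where
  pointwise : ∀ x → w x * point u a x ≡ point u (w u * a) x
  pointwise x with x ≟ u
  ... | yes refl = trans (cong (w x *_) (point-same x a)) (sym (point-same x _))
  ... | no x≢u   = trans (cong (w x *_) (point-other a x≢u)) (trans (*-zeroʳ (w x)) (sym (point-other _ x≢u)))

·-onesʳ : ∀ (w : Fin m → ℕ) → w · ones ≡ ∑ w
·-onesʳ w = ∑-cong (λ x → *-identityʳ (w x))

·-onesˡ : ∀ (C : Fin m → ℕ) → ones · C ≡ ∑ C
·-onesˡ C = ∑-cong (λ x → +-identityʳ (C x))

·-stuck-≤ : ∀ (w : Fin m → ℕ) → (∀ x → ¬ (1 ≤ w x × 2 ≤ C x)) → w · C ≤ ∑ w
·-stuck-≤ {C = C} w stuck = ∑-mono-≤ bound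
  where
  bound : ∀ x → w x * C x ≤ w x
  bound x with 2 ≤? C x
  ... | yes 2≤Cx = ≤-reflexive (trans (cong (_* C x) weightless) (sym weightless))
    where
    weightless : w x ≡ 0
    weightless = n<1⇒n≡0 (≰⇒> (λ 1≤wx → stuck x (1≤wx , 2≤Cx)))
  ... | no  2≰Cx = ≤-trans (*-monoʳ-≤ (w x) (≤-pred (≰⇒> 2≰Cx))) (≤-reflexive (*-identityʳ (w x)))

-- Pebbling moves

move-conserves : u ≢ v → 2 ≤ C u → ∀ x → move C u v x + point u 2 x ≡ C x + point v 1 x
move-conserves {u = u} {v} {C} u≢v 2≤Cu x with x ≟ u | x ≟ v
... | yes refl | yes refl = ⊥-elim (u≢v refl)
... | yes refl | no  x≢v  = begin
  C x ∸ 2 + point x 2 x  ≡⟨ cong (C x ∸ 2 +_) (point-same x 2) ⟩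
  C x ∸ 2 + 2            ≡⟨ m∸n+n≡m 2≤Cu ⟩
  C x                    ≡⟨ +-identityʳ (C x) ⟨
  C x + 0                ≡⟨ cong (C x +_) (point-other 1 x≢v) ⟨
  C x + point v 1 x      ∎
  where open ≡-Reasoning
... | no  x≢u  | yes refl = trans (cong (C x + 1 +_) (point-other 2 x≢u))
                                  (trans (+-identityʳ _) (cong (C x +_) (sym (point-same x 1))))
... | no  x≢u  | no  x≢v  = trans (cong (C x +_) (point-other 2 x≢u)) (cong (C x +_) (sym (point-other 1 x≢v)))

·-move : ∀ (w : Fin m → ℕ) → u ≢ v → 2 ≤ C u → w · move C u v + 2 * w u ≡ w · C + w v
·-move {u = u} {v} {C} w u≢v 2≤Cu = begin
  w · move C u v + 2 * w u               ≡⟨ cong (w · move C u v +_) (trans (·-point w u 2) (*-comm (w u) 2)) ⟨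
  w · move C u v + w · point u 2         ≡⟨ ·-distribʳ-+ w (move C u v) (point u 2) ⟨
  w · (λ x → move C u v x + point u 2 x) ≡⟨ ·-congʳ w (move-conserves u≢v 2≤Cu) ⟩
  w · (λ x → C x + point v 1 x)          ≡⟨ ·-distribʳ-+ w C (point v 1) ⟩
  w · C + w · point v 1                  ≡⟨ cong (w · C +_) (trans (·-point w v 1) (*-identityʳ (w v))) ⟩
  w · C + w v                            ∎
  where open ≡-Reasoning

·-move-heavier : ∀ (w : Fin m → ℕ) → u ≢ v → 2 ≤ C u → 2 * w u ≤ w v → w · C ≤ w · move C u v
·-move-heavier {u = u} {v} {C} w u≢v 2≤Cu heavier = +-cancelʳ-≤ (2 * w u) _ _ (begin
  w · C + 2 * w u            ≤⟨ +-monoʳ-≤ (w · C) heavier ⟩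
  w · C + w v                ≡⟨ ·-move w u≢v 2≤Cu ⟨
  w · move C u v + 2 * w u   ∎)
  where open ≤-Reasoning

∑-move : u ≢ v → 2 ≤ C u → suc (∑ (move C u v)) ≡ ∑ C
∑-move {u = u} {v} {C} u≢v 2≤Cu = +-cancelʳ-≡ 1 _ _ (begin
  suc (∑ (move C u v)) + 1  ≡⟨ +-suc (∑ (move C u v)) 1 ⟨
  ∑ (move C u v) + 2        ≡⟨ cong (_+ 2) (·-onesˡ (move C u v)) ⟨
  ones · move C u v + 2     ≡⟨ ·-move ones u≢v 2≤Cu ⟩
  ones · C + 1              ≡⟨ cong (_+ 1) (·-onesˡ C) ⟩
  ∑ C + 1                   ∎)
  where open ≡-Reasoning

move-target : u ≢ v → move C u v v ≡ C v + 1
move-target {u = u} {v} u≢v with v ≟ u | v ≟ v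
... | yes refl | _        = ⊥-elim (u≢v refl)
... | no  _    | yes _    = refl
... | no  _    | no  v≢v  = ⊥-elim (v≢v refl)

move-mono-≤ : (∀ x → F x ≤ C x) → ∀ x → move F u v x ≤ move C u v x
move-mono-≤ {u = u} {v} F≤C x with x ≟ u | x ≟ v
... | yes _ | _     = ∸-monoˡ-≤ 2 (F≤C x)
... | no _  | yes _ = +-monoˡ-≤ 1 (F≤C x)
... | no _  | no _  = F≤C x

module _ {G : Graph} where

  step-solvable : ∀ {C : Config G} {u v r} → Adj G u v → 2 ≤ C u →
                  Solvable G (move C u v) r → Solvable G C r
  step-solvable a 2≤Cu (D , steps , pebbled) = D , step _ _ a 2≤Cu ◅ steps , pebbled

  Reach-mono : ∀ {F D C : Config G} → Reach G F D → (∀ x → F x ≤ C x) →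
               ∃[ D′ ] (Reach G C D′ × ∀ x → D x ≤ D′ x)
  Reach-mono ε F≤C = _ , ε , F≤C
  Reach-mono (step u v a 2≤Fu ◅ steps) F≤C
    with D′ , steps′ , D≤D′ ← Reach-mono steps (move-mono-≤ F≤C)
    = D′ , step u v a (≤-trans 2≤Fu (F≤C u)) ◅ steps′ , D≤D′

  Solvable-mono : ∀ {F C : Config G} {r} → Solvable G F r → (∀ x → F x ≤ C x) → Solvable G C r
  Solvable-mono {r = r} (D , steps , pebbled) F≤C
    with D′ , steps′ , D≤D′ ← Reach-mono steps F≤C
    = D′ , steps′ , ≤-trans pebbled (D≤D′ r)

-- Weight functions

record Strategy (m : ℕ) : Set where
  field
    weights : Fin m → ℕ
    parent  : Fin m → Fin m

combined : List (ℕ × Strategy m) → Fin m → ℕ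
combined []             _ = 0
combined ((k , s) ∷ cs) x = k * Strategy.weights s x + combined cs x

∑-combined : ∀ k (s : Strategy m) cs →
             ∑ (combined ((k , s) ∷ cs)) ≡ k * ∑ (Strategy.weights s) + ∑ (combined cs)
∑-combined k s cs = begin
  ∑ W                                   ≡⟨ ·-onesʳ W ⟨
  W · ones                              ≡⟨ ·-linearˡ k w (combined cs) ones ⟩
  k * (w · ones) + combined cs · ones   ≡⟨ cong₂ (λ a b → k * a + b) (·-onesʳ w) (·-onesʳ (combined cs)) ⟩
  k * ∑ w + ∑ (combined cs)             ∎
  where
  open ≡-Reasoning
  w W : Fin _ → ℕ
  w = Strategy.weights s
  W = combined ((k , s) ∷ cs)

-- The strategies of Hurlbert's weight function lemma, except that the parent map
-- need not form a tree.
Feeds : ∀ G → Fin (n G) → Strategy (n G) → Fin (n G) → Set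
Feeds G r s x = Adj G x (parent x) × (parent x ≡ r ⊎ 2 * weights x ≤ weights (parent x))
  where open Strategy s

IsStrategy : ∀ G → Fin (n G) → Strategy (n G) → Set
IsStrategy G r s = Strategy.weights s r ≡ 0 × ∀ x → Strategy.weights s x ≡ 0 ⊎ Feeds G r s x

module _ {G : Graph} where

  module _ {r : Fin (n G)} {s : Strategy (n G)} (valid : IsStrategy G r s) where
    open Strategy s

    private
      feeds : ∀ {x} → 1 ≤ weights x → Feeds G r s x
      feeds {x} 1≤wx with proj₂ valid x
      ... | inj₁ wx≡0 = ⊥-elim (<⇒≢ 1≤wx (sym wx≡0))
      ... | inj₂ fed  = fed

      parent-distinct : ∀ {x} → 1 ≤ weights x → x ≢ parent x
      parent-distinct 1≤wx x≡p with proj₂ (feeds 1≤wx)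
      ... | inj₁ p≡r      = <⇒≢ 1≤wx (sym (trans (cong weights (trans x≡p p≡r)) (proj₁ valid)))
      ... | inj₂ doubling = <⇒≱ (m<m+n (weights _) 1≤wx)
        (subst₂ _≤_ (cong (weights _ +_) (+-identityʳ _)) (cong weights (sym x≡p)) doubling)

    -- A move from a weighted vertex to its parent spends a pebble without lowering
    -- weights · C, so while the gain persists such moves continue until one reaches r.
    strategy-solvable : ∀ (C : Config G) → ∑ weights < weights · C → Solvable G C r
    strategy-solvable C = go C (<-wellFounded (∑ C))
      where
      go : ∀ C → Acc _<_ (∑ C) → ∑ weights < weights · C → Solvable G C r
      go C (acc smaller) gain with any? (λ x → 1 ≤? weights x ×-dec 2 ≤? C x)
      ... | no  stuck = ⊥-elim (<⇒≱ gain (·-stuck-≤ weights (λ x → stuck ∘ (x ,_))))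
      ... | yes (v , 1≤wv , 2≤Cv) = step-solvable (proj₁ (feeds 1≤wv)) 2≤Cv (advance (proj₂ (feeds 1≤wv)))
        where
        v≢p : v ≢ parent v
        v≢p = parent-distinct 1≤wv
        C′ : Config G
        C′ = move C v (parent v)
        advance : parent v ≡ r ⊎ 2 * weights v ≤ weights (parent v) → Solvable G C′ r
        advance (inj₁ refl)     = C′ , ε , subst (1 ≤_) (sym (move-target v≢p)) (m≤n+m 1 _)
        advance (inj₂ doubling) = go C′ (smaller (≤-reflexive (∑-move v≢p 2≤Cv)))
          (<-≤-trans gain (·-move-heavier weights v≢p 2≤Cv doubling))

  combination-solvable : ∀ {r cs} (C : Config G) → All (IsStrategy G r ∘ proj₂) cs →
                         ∑ (combined cs) < combined cs · C → Solvable G C r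
  combination-solvable C [] gain = ⊥-elim (<-irrefl refl gain)
  combination-solvable {cs = (k , s) ∷ cs} C (valid ∷ valids) gain
    with k * ∑ weights <? k * (weights · C)
    where open Strategy s
  ... | yes gainₛ = strategy-solvable valid C (*-cancelˡ-< k _ _ gainₛ)
  ... | no  lossₛ = combination-solvable C valids
    (cancel (subst₂ _<_ (∑-combined k s cs) (·-linearˡ k (Strategy.weights s) (combined cs) C) gain) (≮⇒≥ lossₛ))
    where
    cancel : ∀ {a b c d} → a + b < c + d → c ≤ a → b < d
    cancel a+b<c+d c≤a = ≰⇒> λ d≤b → <⇒≱ a+b<c+d (+-mono-≤ c≤a d≤b)

-- Certificates

data Bound : Set where
  atLeast exactly : ℕ → Bound

lowest : Bound → ℕ
lowest (atLeast a) = a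
lowest (exactly a) = a

infix 4 _⊨_

_⊨_ : ℕ → Bound → Set
c ⊨ atLeast a = a ≤ c
c ⊨ exactly a = c ≡ a

Exact : Bound → Set
Exact (atLeast _) = ⊥
Exact (exactly _) = ⊤

exact? : ∀ b → Dec (Exact b)
exact? (atLeast _) = no λ ()
exact? (exactly _) = yes tt

pin raise : Bound → Bound
pin (atLeast a)   = exactly a
pin (exactly a)   = exactly a
raise (atLeast a) = atLeast (suc a)
raise (exactly a) = exactly a

⊨⇒lowest≤ : ∀ {c} b → c ⊨ b → lowest b ≤ c
⊨⇒lowest≤ (atLeast a) a≤c  = a≤c
⊨⇒lowest≤ (exactly a) refl = ≤-refl

⊨-exact : ∀ {c} b → Exact b → c ⊨ b → c ≡ lowest b
⊨-exact (exactly a) _ c≡a = c≡a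

⊨-pin⊎raise : ∀ {c} b → c ⊨ b → c ⊨ pin b ⊎ c ⊨ raise b
⊨-pin⊎raise (atLeast a) a≤c with m≤n⇒m<n∨m≡n a≤c
... | inj₁ a<c = inj₂ a<c
... | inj₂ a≡c = inj₁ (sym a≡c)
⊨-pin⊎raise (exactly a) c≡a = inj₁ c≡a

Constraints : ℕ → Set
Constraints m = Fin m → Bound

least : Constraints m → Fin m → ℕ
least B x = lowest (B x)

Satisfies : Constraints m → (Fin m → ℕ) → Set
Satisfies B C = ∀ x → C x ⊨ B x

Satisfies-updateAt : ∀ (B : Constraints m) v {f} → C v ⊨ f (B v) → Satisfies B C →
                     Satisfies (updateAt B v f) C
Satisfies-updateAt {C = C} B v Cv⊨ sat x with x ≟ v
... | yes refl = subst (C x ⊨_) (sym (updateAt-updates x B)) Cv⊨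
... | no  x≢v  = subst (C x ⊨_) (sym (updateAt-minimal x v B x≢v)) (sat x)

emptyAt : Fin m → Constraints m
emptyAt r = updateAt (λ _ → atLeast 0) r (λ _ → exactly 0)

Satisfies-emptyAt : ∀ (r : Fin m) → C r ≡ 0 → Satisfies (emptyAt r) C
Satisfies-emptyAt r Cr≡0 = Satisfies-updateAt (λ _ → atLeast 0) r Cr≡0 (λ _ → z≤n)

Satisfies-split : ∀ (B : Constraints m) v → Satisfies B C →
                  Satisfies (updateAt B v pin) C ⊎ Satisfies (updateAt B v raise) C
Satisfies-split B v sat with ⊨-pin⊎raise (B v) (sat v)
... | inj₁ pinned = inj₁ (Satisfies-updateAt B v pinned sat)
... | inj₂ raised = inj₂ (Satisfies-updateAt B v raised sat)

·-least-≤ : ∀ (B : Constraints m) (W : Fin m → ℕ) μ → Satisfies B C → ∑ C ≡ t →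
            (∀ x → Exact (B x) ⊎ μ ≤ W x) → W · least B + μ * (t ∸ ∑ (least B)) ≤ W · C
·-least-≤ {C = C} B W μ sat refl μ≤W = begin
  W · least B + μ * (∑ C ∸ ∑ (least B))         ≡⟨ cong (λ e → W · least B + μ * e) (∑-distrib-∸ lowest≤) ⟨
  W · least B + μ * ∑ extra                     ≡⟨ cong (W · least B +_) (∑-distribˡ-* μ extra) ⟨
  W · least B + ∑ (λ x → μ * extra x)           ≡⟨ ∑-distrib-+ (λ x → W x * least B x) (λ x → μ * extra x) ⟨
  ∑ (λ x → W x * least B x + μ * extra x)       ≤⟨ ∑-mono-≤ pointwise ⟩
  W · C                                         ∎
  where
  open ≤-Reasoning
  lowest≤ : ∀ x → least B x ≤ C x
  lowest≤ x = ⊨⇒lowest≤ (B x) (sat x)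
  extra : Fin _ → ℕ
  extra x = C x ∸ least B x
  pointwise : ∀ x → W x * least B x + μ * (C x ∸ least B x) ≤ W x * C x
  pointwise x with μ≤W x
  ... | inj₁ exact rewrite ⊨-exact (B x) exact (sat x) | n∸n≡0 (lowest (B x)) | *-zeroʳ μ =
    ≤-reflexive (+-identityʳ _)
  ... | inj₂ μ≤Wx = begin
    W x * least B x + μ * (C x ∸ least B x)     ≤⟨ +-monoʳ-≤ (W x * least B x) (*-monoˡ-≤ _ μ≤Wx) ⟩
    W x * least B x + W x * (C x ∸ least B x)   ≡⟨ *-distribˡ-+ (W x) _ _ ⟨
    W x * (least B x + (C x ∸ least B x))       ≡⟨ cong (W x *_) (m+[n∸m]≡n (lowest≤ x)) ⟩
    W x * C x                                   ∎

data Certificate (m : ℕ) : Set where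
  byMoves      : List (Fin m × Fin m) → Certificate m
  infeasible   : Certificate m
  byStrategies : ℕ → List (ℕ × Strategy m) → Certificate m
  split        : Fin m → Certificate m → Certificate m → Certificate m

module Certification (G : Graph) (r : Fin (n G)) (t : ℕ) where

  private
    V : Set
    V = Fin (n G)

  Solves : List (V × V) → Config G → Set
  Solves []             D = 1 ≤ D r
  Solves ((u , v) ∷ ms) D = Adj G u v × 2 ≤ D u × Solves ms (move D u v)

  Solves-solvable : ∀ ms D → Solves ms D → Solvable G D r
  Solves-solvable []             D pebbled          = D , ε , pebbled
  Solves-solvable ((u , v) ∷ ms) D (a , 2≤Du , run) = step-solvable a 2≤Du (Solves-solvable ms (move D u v) run)

  -- In byStrategies μ cs every pebble beyond least B lies on a vertex of combined weight ≥ μ.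
  Valid : Constraints (n G) → Certificate (n G) → Set
  Valid B (byMoves ms)        = Solves ms (least B)
  Valid B infeasible          = t < ∑ (least B) ⊎ (∀ x → Exact (B x)) × ∑ (least B) ≢ t
  Valid B (byStrategies μ cs) = All (IsStrategy G r ∘ proj₂) cs
                              × (∀ x → Exact (B x) ⊎ μ ≤ combined cs x)
                              × ∑ (combined cs) < combined cs · least B + μ * (t ∸ ∑ (least B))
  Valid B (split v c d)       = Valid (updateAt B v pin) c × Valid (updateAt B v raise) d

  Valid-solvable : ∀ B c → Valid B c → ∀ C → Satisfies B C → ∑ C ≡ t → Solvable G C r
  Valid-solvable B (byMoves ms) run C sat _ =
    Solvable-mono (Solves-solvable ms (least B) run) (λ x → ⊨⇒lowest≤ (B x) (sat x))
  Valid-solvable B infeasible (inj₁ t<∑B) C sat ∑C≡t =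
    ⊥-elim (<⇒≱ t<∑B (subst (∑ (least B) ≤_) ∑C≡t (∑-mono-≤ λ x → ⊨⇒lowest≤ (B x) (sat x))))
  Valid-solvable B infeasible (inj₂ (exact , ∑B≢t)) C sat ∑C≡t =
    ⊥-elim (∑B≢t (trans (∑-cong (λ x → sym (⊨-exact (B x) (exact x) (sat x)))) ∑C≡t))
  Valid-solvable B (byStrategies μ cs) (valid , μ≤W , gain) C sat ∑C≡t =
    combination-solvable C valid (<-≤-trans gain (·-least-≤ B (combined cs) μ sat ∑C≡t μ≤W))
  Valid-solvable B (split v c d) (valid-c , valid-d) C sat ∑C≡t with Satisfies-split B v sat
  ... | inj₁ pinned = Valid-solvable _ c valid-c C pinned ∑C≡t
  ... | inj₂ raised = Valid-solvable _ d valid-d C raised ∑C≡t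

  AllSolvable-certified : ∀ c → Valid (emptyAt r) c → AllSolvable G r t
  AllSolvable-certified c valid C ∑C≡t with 1 ≤? C r
  ... | yes pebbled = C , ε , pebbled
  ... | no  empty   = Valid-solvable (emptyAt r) c valid C (Satisfies-emptyAt r (n<1⇒n≡0 (≰⇒> empty))) ∑C≡t

  module _ (adj? : ∀ u v → Dec (Adj G u v)) where

    feeds? : ∀ s x → Dec (Feeds G r s x)
    feeds? s x = adj? x (parent x) ×-dec (parent x ≟ r ⊎-dec 2 * weights x ≤? weights (parent x))
      where open Strategy s

    isStrategy? : ∀ s → Dec (IsStrategy G r s)
    isStrategy? s = weights r ℕ.≟ 0 ×-dec all? (λ x → weights x ℕ.≟ 0 ⊎-dec feeds? s x)
      where open Strategy s

    solves? : ∀ ms D → Dec (Solves ms D)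
    solves? []             D = 1 ≤? D r
    solves? ((u , v) ∷ ms) D = adj? u v ×-dec 2 ≤? D u ×-dec solves? ms (move D u v)

    valid? : ∀ B c → Dec (Valid B c)
    valid? B (byMoves ms)        = solves? ms (least B)
    valid? B infeasible          = t <? ∑ (least B) ⊎-dec all? (exact? ∘ B) ×-dec ¬? (∑ (least B) ℕ.≟ t)
    valid? B (byStrategies μ cs) = All.all? (isStrategy? ∘ proj₂) cs
                                 ×-dec all? (λ x → exact? (B x) ⊎-dec μ ≤? combined cs x)
                                 ×-dec ∑ (combined cs) <? combined cs · least B + μ * (t ∸ ∑ (least B))
    valid? B (split v c d)       = valid? (updateAt B v pin) c ×-dec valid? (updateAt B v raise) d

-- The lower bound

unit-config : ∀ {m} s → s ≤ m → ∃[ C ] ((∀ x → C x ≤ 1) × ∑ {m} C ≡ s)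
unit-config {m}     zero    _         = (λ _ → 0) , (λ _ → z≤n) , ∑-zero {m}
unit-config {suc m} (suc s) (s≤s s≤m) with C , C≤1 , ∑C≡s ← unit-config s s≤m =
  1 Vector.∷ C , (λ { fzero → ≤-refl ; (fsuc x) → C≤1 x }) , cong suc ∑C≡s

sparse-config : ∀ {m} (r : Fin m) s → s < m → ∃[ C ] (C r ≡ 0 × (∀ x → C x ≤ 1) × ∑ C ≡ s)
sparse-config fzero s (s≤s s≤m) with C , C≤1 , ∑C≡s ← unit-config s s≤m =
  0 Vector.∷ C , refl , (λ { fzero → z≤n ; (fsuc x) → C≤1 x }) , ∑C≡s
sparse-config {m} (fsuc r) zero _ = (λ _ → 0) , refl , (λ _ → z≤n) , ∑-zero {m}
sparse-config (fsuc r) (suc s) (s≤s s<m) with C , Cr≡0 , C≤1 , ∑C≡s ← sparse-config r s s<m =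
  1 Vector.∷ C , Cr≡0 , (λ { fzero → ≤-refl ; (fsuc x) → C≤1 x }) , cong suc ∑C≡s

sparse-unsolvable : ∀ {G} {C : Config G} {r} → C r ≡ 0 → (∀ x → C x ≤ 1) → ¬ Solvable G C r
sparse-unsolvable Cr≡0 _   (_ , ε , pebbled)                = <⇒≢ pebbled (sym Cr≡0)
sparse-unsolvable _    C≤1 (_ , step u _ _ 2≤Cu ◅ _ , _) = <⇒≱ 2≤Cu (C≤1 u)

AllSolvable⇒n≤ : ∀ G r s → AllSolvable G r s → n G ≤ s
AllSolvable⇒n≤ G r s solvable = ≮⇒≥ λ s<n →
  let C , Cr≡0 , C≤1 , ∑C≡s = sparse-config r s s<n
  in sparse-unsolvable Cr≡0 C≤1 (solvable C ∑C≡s)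

AllSolvable⇒Class0 : ∀ G → Fin (n G) → (∀ r → AllSolvable G r (n G)) → Class0 G
AllSolvable⇒Class0 G r₀ solvable = (λ r → n G , rooted r , ≤-refl) , r₀ , rooted r₀
  where
  rooted : ∀ r → IsRootedPebblingNumber G r (n G)
  rooted r = solvable r , AllSolvable⇒n≤ G r

-- The graph R₁₅

adj? : ∀ u v → Dec (Adj R15 u v)
adj? u v = suc (toℕ v) ∈? R15-nbrs u

-- Parents are listed by vertex index; all indices are below 15, so mod 15 changes nothing.
strategy : Vec ℕ 15 → Vec ℕ 15 → Strategy 15
strategy ws ps = record { weights = Vec.lookup ws ; parent = λ x → Vec.lookup ps x mod 15 }

certificate₀ : Certificate 15
certificate₀ =
  byStrategies 40507890
    ( (664815 , strategy (0 ∷ 4 ∷ 4 ∷ 16 ∷ 2 ∷ 4 ∷ 8 ∷ 4 ∷ 2 ∷ 2 ∷ 2 ∷ 1 ∷ 2 ∷ 8 ∷ 2 ∷ [])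
                         (0 ∷ 13 ∷ 6 ∷ 0 ∷ 7 ∷ 13 ∷ 3 ∷ 13 ∷ 5 ∷ 7 ∷ 1 ∷ 12 ∷ 7 ∷ 3 ∷ 7 ∷ []))
    ∷ (2081160 , strategy (0 ∷ 0 ∷ 4 ∷ 8 ∷ 0 ∷ 0 ∷ 4 ∷ 0 ∷ 4 ∷ 1 ∷ 2 ∷ 0 ∷ 0 ∷ 0 ∷ 1 ∷ [])
                          (0 ∷ 0 ∷ 3 ∷ 0 ∷ 0 ∷ 0 ∷ 3 ∷ 0 ∷ 3 ∷ 10 ∷ 6 ∷ 0 ∷ 0 ∷ 0 ∷ 10 ∷ []))
    ∷ (664815 , strategy (0 ∷ 2 ∷ 1 ∷ 8 ∷ 4 ∷ 2 ∷ 4 ∷ 32 ∷ 8 ∷ 16 ∷ 8 ∷ 4 ∷ 64 ∷ 16 ∷ 16 ∷ [])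
                         (0 ∷ 11 ∷ 5 ∷ 13 ∷ 10 ∷ 4 ∷ 10 ∷ 12 ∷ 9 ∷ 7 ∷ 9 ∷ 10 ∷ 0 ∷ 7 ∷ 7 ∷ []))
    ∷ (31911120 , strategy (0 ∷ 0 ∷ 0 ∷ 0 ∷ 0 ∷ 0 ∷ 0 ∷ 0 ∷ 0 ∷ 0 ∷ 0 ∷ 1 ∷ 0 ∷ 0 ∷ 0 ∷ [])
                           (0 ∷ 0 ∷ 0 ∷ 0 ∷ 0 ∷ 0 ∷ 0 ∷ 0 ∷ 0 ∷ 0 ∷ 0 ∷ 0 ∷ 0 ∷ 0 ∷ 0 ∷ []))
    ∷ (1063704 , strategy (0 ∷ 8 ∷ 0 ∷ 0 ∷ 0 ∷ 0 ∷ 2 ∷ 0 ∷ 0 ∷ 2 ∷ 4 ∷ 0 ∷ 0 ∷ 4 ∷ 1 ∷ [])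
                          (0 ∷ 0 ∷ 0 ∷ 0 ∷ 0 ∷ 0 ∷ 10 ∷ 0 ∷ 0 ∷ 10 ∷ 1 ∷ 0 ∷ 0 ∷ 1 ∷ 6 ∷ []))
    ∷ (3113280 , strategy (0 ∷ 0 ∷ 0 ∷ 4 ∷ 0 ∷ 0 ∷ 2 ∷ 0 ∷ 2 ∷ 1 ∷ 0 ∷ 0 ∷ 0 ∷ 2 ∷ 1 ∷ [])
                          (0 ∷ 0 ∷ 0 ∷ 0 ∷ 0 ∷ 0 ∷ 3 ∷ 0 ∷ 3 ∷ 8 ∷ 0 ∷ 0 ∷ 0 ∷ 3 ∷ 6 ∷ []))
    ∷ (4162320 , strategy (0 ∷ 0 ∷ 4 ∷ 0 ∷ 0 ∷ 8 ∷ 0 ∷ 2 ∷ 4 ∷ 1 ∷ 0 ∷ 0 ∷ 0 ∷ 4 ∷ 0 ∷ [])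
                          (0 ∷ 0 ∷ 5 ∷ 0 ∷ 0 ∷ 0 ∷ 0 ∷ 13 ∷ 5 ∷ 7 ∷ 0 ∷ 0 ∷ 0 ∷ 5 ∷ 0 ∷ []))
    ∷ (886420 , strategy (0 ∷ 8 ∷ 0 ∷ 0 ∷ 0 ∷ 0 ∷ 1 ∷ 0 ∷ 0 ∷ 2 ∷ 4 ∷ 0 ∷ 0 ∷ 0 ∷ 2 ∷ [])
                         (0 ∷ 0 ∷ 0 ∷ 0 ∷ 0 ∷ 0 ∷ 14 ∷ 0 ∷ 0 ∷ 10 ∷ 1 ∷ 0 ∷ 0 ∷ 0 ∷ 10 ∷ []))
    ∷ (2715840 , strategy (0 ∷ 8 ∷ 4 ∷ 0 ∷ 0 ∷ 0 ∷ 2 ∷ 4 ∷ 0 ∷ 2 ∷ 0 ∷ 0 ∷ 0 ∷ 0 ∷ 1 ∷ [])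
                          (0 ∷ 0 ∷ 1 ∷ 0 ∷ 0 ∷ 0 ∷ 2 ∷ 1 ∷ 0 ∷ 7 ∷ 0 ∷ 0 ∷ 0 ∷ 0 ∷ 6 ∷ []))
    ∷ (664815 , strategy (0 ∷ 0 ∷ 4 ∷ 0 ∷ 0 ∷ 8 ∷ 2 ∷ 0 ∷ 4 ∷ 1 ∷ 2 ∷ 0 ∷ 0 ∷ 0 ∷ 0 ∷ [])
                         (0 ∷ 0 ∷ 5 ∷ 0 ∷ 0 ∷ 0 ∷ 2 ∷ 0 ∷ 5 ∷ 10 ∷ 8 ∷ 0 ∷ 0 ∷ 0 ∷ 0 ∷ []))
    ∷ (664815 , strategy (0 ∷ 0 ∷ 0 ∷ 0 ∷ 0 ∷ 0 ∷ 2 ∷ 0 ∷ 0 ∷ 2 ∷ 4 ∷ 8 ∷ 0 ∷ 0 ∷ 1 ∷ [])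
                         (0 ∷ 0 ∷ 0 ∷ 0 ∷ 0 ∷ 0 ∷ 10 ∷ 0 ∷ 0 ∷ 10 ∷ 11 ∷ 0 ∷ 0 ∷ 0 ∷ 6 ∷ []))
    ∷ (9307410 , strategy (0 ∷ 0 ∷ 0 ∷ 0 ∷ 4 ∷ 0 ∷ 1 ∷ 0 ∷ 0 ∷ 1 ∷ 2 ∷ 0 ∷ 0 ∷ 0 ∷ 2 ∷ [])
                          (0 ∷ 0 ∷ 0 ∷ 0 ∷ 0 ∷ 0 ∷ 14 ∷ 0 ∷ 0 ∷ 10 ∷ 4 ∷ 0 ∷ 0 ∷ 0 ∷ 4 ∷ []))
    ∷ [])

certificate₁ : Certificate 15
certificate₁ =
  byStrategies 3179
    ( (720 , strategy (0 ∷ 0 ∷ 0 ∷ 0 ∷ 0 ∷ 2 ∷ 0 ∷ 0 ∷ 1 ∷ 0 ∷ 0 ∷ 0 ∷ 1 ∷ 4 ∷ 0 ∷ [])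
                      (1 ∷ 1 ∷ 1 ∷ 1 ∷ 1 ∷ 13 ∷ 1 ∷ 1 ∷ 5 ∷ 1 ∷ 1 ∷ 1 ∷ 5 ∷ 1 ∷ 1 ∷ []))
    ∷ (160 , strategy (8 ∷ 0 ∷ 2 ∷ 0 ∷ 2 ∷ 4 ∷ 0 ∷ 0 ∷ 0 ∷ 0 ∷ 0 ∷ 0 ∷ 4 ∷ 0 ∷ 1 ∷ [])
                      (1 ∷ 1 ∷ 5 ∷ 1 ∷ 5 ∷ 0 ∷ 1 ∷ 1 ∷ 1 ∷ 1 ∷ 1 ∷ 1 ∷ 0 ∷ 1 ∷ 4 ∷ []))
    ∷ (72 , strategy (0 ∷ 0 ∷ 1 ∷ 0 ∷ 0 ∷ 0 ∷ 2 ∷ 0 ∷ 2 ∷ 4 ∷ 8 ∷ 4 ∷ 2 ∷ 0 ∷ 4 ∷ [])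
                     (1 ∷ 1 ∷ 6 ∷ 1 ∷ 1 ∷ 1 ∷ 14 ∷ 1 ∷ 9 ∷ 10 ∷ 1 ∷ 10 ∷ 11 ∷ 1 ∷ 10 ∷ []))
    ∷ (45 , strategy (4 ∷ 0 ∷ 4 ∷ 4 ∷ 8 ∷ 2 ∷ 8 ∷ 32 ∷ 2 ∷ 4 ∷ 8 ∷ 8 ∷ 16 ∷ 1 ∷ 16 ∷ [])
                     (4 ∷ 1 ∷ 6 ∷ 4 ∷ 14 ∷ 0 ∷ 14 ∷ 1 ∷ 3 ∷ 10 ∷ 14 ∷ 12 ∷ 7 ∷ 5 ∷ 7 ∷ []))
    ∷ (45 , strategy (4 ∷ 0 ∷ 2 ∷ 4 ∷ 8 ∷ 2 ∷ 2 ∷ 16 ∷ 2 ∷ 2 ∷ 4 ∷ 2 ∷ 1 ∷ 8 ∷ 8 ∷ [])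
                     (4 ∷ 1 ∷ 3 ∷ 4 ∷ 7 ∷ 0 ∷ 3 ∷ 1 ∷ 10 ∷ 10 ∷ 14 ∷ 0 ∷ 5 ∷ 7 ∷ 7 ∷ []))
    ∷ (72 , strategy (0 ∷ 0 ∷ 0 ∷ 0 ∷ 1 ∷ 2 ∷ 0 ∷ 0 ∷ 4 ∷ 4 ∷ 8 ∷ 0 ∷ 0 ∷ 0 ∷ 0 ∷ [])
                     (1 ∷ 1 ∷ 1 ∷ 1 ∷ 5 ∷ 8 ∷ 1 ∷ 1 ∷ 10 ∷ 10 ∷ 1 ∷ 1 ∷ 1 ∷ 1 ∷ 1 ∷ []))
    ∷ (720 , strategy (0 ∷ 0 ∷ 2 ∷ 4 ∷ 2 ∷ 0 ∷ 2 ∷ 0 ∷ 2 ∷ 1 ∷ 0 ∷ 0 ∷ 0 ∷ 0 ∷ 1 ∷ [])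
                      (1 ∷ 1 ∷ 3 ∷ 1 ∷ 3 ∷ 1 ∷ 3 ∷ 1 ∷ 3 ∷ 8 ∷ 1 ∷ 1 ∷ 1 ∷ 1 ∷ 6 ∷ []))
    ∷ (336 , strategy (0 ∷ 0 ∷ 1 ∷ 0 ∷ 2 ∷ 0 ∷ 2 ∷ 0 ∷ 0 ∷ 2 ∷ 4 ∷ 8 ∷ 0 ∷ 0 ∷ 1 ∷ [])
                      (1 ∷ 1 ∷ 6 ∷ 1 ∷ 10 ∷ 1 ∷ 10 ∷ 1 ∷ 1 ∷ 10 ∷ 11 ∷ 1 ∷ 1 ∷ 1 ∷ 6 ∷ []))
    ∷ (96 , strategy (0 ∷ 0 ∷ 1 ∷ 0 ∷ 2 ∷ 0 ∷ 2 ∷ 0 ∷ 1 ∷ 2 ∷ 4 ∷ 0 ∷ 0 ∷ 0 ∷ 1 ∷ [])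
                     (1 ∷ 1 ∷ 6 ∷ 1 ∷ 10 ∷ 1 ∷ 10 ∷ 1 ∷ 9 ∷ 10 ∷ 1 ∷ 1 ∷ 1 ∷ 1 ∷ 6 ∷ []))
    ∷ (420 , strategy (4 ∷ 0 ∷ 1 ∷ 0 ∷ 0 ∷ 2 ∷ 0 ∷ 0 ∷ 1 ∷ 0 ∷ 0 ∷ 0 ∷ 1 ∷ 0 ∷ 0 ∷ [])
                      (1 ∷ 1 ∷ 5 ∷ 1 ∷ 1 ∷ 0 ∷ 1 ∷ 1 ∷ 5 ∷ 1 ∷ 1 ∷ 1 ∷ 5 ∷ 1 ∷ 1 ∷ []))
    ∷ (225 , strategy (0 ∷ 0 ∷ 1 ∷ 0 ∷ 0 ∷ 0 ∷ 2 ∷ 8 ∷ 0 ∷ 4 ∷ 0 ∷ 0 ∷ 4 ∷ 0 ∷ 4 ∷ [])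
                      (1 ∷ 1 ∷ 6 ∷ 1 ∷ 1 ∷ 1 ∷ 14 ∷ 1 ∷ 1 ∷ 7 ∷ 1 ∷ 1 ∷ 7 ∷ 1 ∷ 7 ∷ []))
    ∷ [])

certificate₂ : Certificate 15
certificate₂ =
  byStrategies 280
    ( (24 , strategy (0 ∷ 0 ∷ 0 ∷ 0 ∷ 0 ∷ 8 ∷ 0 ∷ 2 ∷ 4 ∷ 2 ∷ 0 ∷ 2 ∷ 4 ∷ 0 ∷ 1 ∷ [])
                     (2 ∷ 2 ∷ 2 ∷ 2 ∷ 2 ∷ 2 ∷ 2 ∷ 12 ∷ 5 ∷ 8 ∷ 2 ∷ 12 ∷ 5 ∷ 2 ∷ 7 ∷ []))
    ∷ (60 , strategy (2 ∷ 4 ∷ 0 ∷ 0 ∷ 1 ∷ 0 ∷ 0 ∷ 2 ∷ 0 ∷ 1 ∷ 2 ∷ 2 ∷ 1 ∷ 2 ∷ 1 ∷ [])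
                     (1 ∷ 2 ∷ 2 ∷ 2 ∷ 0 ∷ 2 ∷ 2 ∷ 1 ∷ 2 ∷ 7 ∷ 1 ∷ 1 ∷ 11 ∷ 1 ∷ 7 ∷ []))
    ∷ (10 , strategy (2 ∷ 4 ∷ 0 ∷ 0 ∷ 0 ∷ 0 ∷ 0 ∷ 2 ∷ 0 ∷ 1 ∷ 0 ∷ 2 ∷ 1 ∷ 0 ∷ 1 ∷ [])
                     (1 ∷ 2 ∷ 2 ∷ 2 ∷ 2 ∷ 2 ∷ 2 ∷ 1 ∷ 2 ∷ 7 ∷ 2 ∷ 1 ∷ 0 ∷ 2 ∷ 7 ∷ []))
    ∷ (30 , strategy (2 ∷ 0 ∷ 0 ∷ 4 ∷ 2 ∷ 0 ∷ 0 ∷ 0 ∷ 2 ∷ 1 ∷ 1 ∷ 1 ∷ 1 ∷ 2 ∷ 1 ∷ [])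
                     (3 ∷ 2 ∷ 2 ∷ 2 ∷ 3 ∷ 2 ∷ 2 ∷ 2 ∷ 3 ∷ 8 ∷ 8 ∷ 0 ∷ 0 ∷ 3 ∷ 4 ∷ []))
    ∷ (45 , strategy (2 ∷ 0 ∷ 0 ∷ 4 ∷ 2 ∷ 0 ∷ 0 ∷ 0 ∷ 2 ∷ 1 ∷ 0 ∷ 1 ∷ 1 ∷ 2 ∷ 0 ∷ [])
                     (3 ∷ 2 ∷ 2 ∷ 2 ∷ 3 ∷ 2 ∷ 2 ∷ 2 ∷ 3 ∷ 8 ∷ 2 ∷ 0 ∷ 0 ∷ 3 ∷ 2 ∷ []))
    ∷ (12 , strategy (0 ∷ 0 ∷ 0 ∷ 0 ∷ 4 ∷ 8 ∷ 0 ∷ 2 ∷ 4 ∷ 2 ∷ 0 ∷ 0 ∷ 1 ∷ 0 ∷ 2 ∷ [])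
                     (2 ∷ 2 ∷ 2 ∷ 2 ∷ 5 ∷ 2 ∷ 2 ∷ 4 ∷ 5 ∷ 8 ∷ 2 ∷ 2 ∷ 7 ∷ 2 ∷ 4 ∷ []))
    ∷ (10 , strategy (0 ∷ 0 ∷ 0 ∷ 0 ∷ 2 ∷ 0 ∷ 8 ∷ 2 ∷ 0 ∷ 2 ∷ 4 ∷ 2 ∷ 1 ∷ 0 ∷ 4 ∷ [])
                     (2 ∷ 2 ∷ 2 ∷ 2 ∷ 14 ∷ 2 ∷ 2 ∷ 14 ∷ 2 ∷ 10 ∷ 6 ∷ 10 ∷ 7 ∷ 2 ∷ 6 ∷ []))
    ∷ (15 , strategy (0 ∷ 0 ∷ 0 ∷ 0 ∷ 2 ∷ 0 ∷ 16 ∷ 4 ∷ 0 ∷ 4 ∷ 8 ∷ 1 ∷ 2 ∷ 2 ∷ 8 ∷ [])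
                     (2 ∷ 2 ∷ 2 ∷ 2 ∷ 7 ∷ 2 ∷ 2 ∷ 14 ∷ 2 ∷ 10 ∷ 6 ∷ 12 ∷ 7 ∷ 7 ∷ 6 ∷ []))
    ∷ [])

certificate₃ : Certificate 15
certificate₃ =
  byStrategies 3936
    ( (280 , strategy (8 ∷ 0 ∷ 0 ∷ 0 ∷ 4 ∷ 2 ∷ 0 ∷ 1 ∷ 0 ∷ 0 ∷ 0 ∷ 4 ∷ 4 ∷ 0 ∷ 2 ∷ [])
                      (3 ∷ 3 ∷ 3 ∷ 3 ∷ 0 ∷ 4 ∷ 3 ∷ 14 ∷ 3 ∷ 3 ∷ 3 ∷ 0 ∷ 0 ∷ 3 ∷ 4 ∷ []))
    ∷ (70 , strategy (0 ∷ 0 ∷ 4 ∷ 0 ∷ 0 ∷ 2 ∷ 0 ∷ 0 ∷ 0 ∷ 0 ∷ 0 ∷ 0 ∷ 1 ∷ 0 ∷ 0 ∷ [])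
                     (3 ∷ 3 ∷ 3 ∷ 3 ∷ 3 ∷ 2 ∷ 3 ∷ 3 ∷ 3 ∷ 3 ∷ 3 ∷ 3 ∷ 5 ∷ 3 ∷ 3 ∷ []))
    ∷ (840 , strategy (0 ∷ 2 ∷ 0 ∷ 0 ∷ 0 ∷ 2 ∷ 0 ∷ 2 ∷ 0 ∷ 1 ∷ 0 ∷ 1 ∷ 1 ∷ 4 ∷ 1 ∷ [])
                      (3 ∷ 13 ∷ 3 ∷ 3 ∷ 3 ∷ 13 ∷ 3 ∷ 13 ∷ 3 ∷ 7 ∷ 3 ∷ 1 ∷ 7 ∷ 3 ∷ 7 ∷ []))
    ∷ (70 , strategy (0 ∷ 0 ∷ 0 ∷ 0 ∷ 0 ∷ 4 ∷ 0 ∷ 4 ∷ 0 ∷ 2 ∷ 0 ∷ 1 ∷ 2 ∷ 8 ∷ 2 ∷ [])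
                     (3 ∷ 3 ∷ 3 ∷ 3 ∷ 3 ∷ 13 ∷ 3 ∷ 13 ∷ 3 ∷ 7 ∷ 3 ∷ 12 ∷ 7 ∷ 3 ∷ 7 ∷ []))
    ∷ (105 , strategy (0 ∷ 0 ∷ 0 ∷ 0 ∷ 0 ∷ 1 ∷ 16 ∷ 4 ∷ 0 ∷ 4 ∷ 8 ∷ 0 ∷ 2 ∷ 0 ∷ 8 ∷ [])
                      (3 ∷ 3 ∷ 3 ∷ 3 ∷ 3 ∷ 12 ∷ 3 ∷ 14 ∷ 3 ∷ 10 ∷ 6 ∷ 3 ∷ 7 ∷ 3 ∷ 6 ∷ []))
    ∷ (84 , strategy (2 ∷ 4 ∷ 1 ∷ 0 ∷ 4 ∷ 2 ∷ 4 ∷ 2 ∷ 32 ∷ 16 ∷ 8 ∷ 2 ∷ 1 ∷ 1 ∷ 2 ∷ [])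
                     (1 ∷ 10 ∷ 5 ∷ 3 ∷ 10 ∷ 4 ∷ 10 ∷ 4 ∷ 3 ∷ 8 ∷ 9 ∷ 1 ∷ 11 ∷ 7 ∷ 4 ∷ []))
    ∷ (120 , strategy (8 ∷ 0 ∷ 0 ∷ 0 ∷ 0 ∷ 4 ∷ 0 ∷ 0 ∷ 0 ∷ 1 ∷ 2 ∷ 4 ∷ 4 ∷ 0 ∷ 0 ∷ [])
                      (3 ∷ 3 ∷ 3 ∷ 3 ∷ 3 ∷ 0 ∷ 3 ∷ 3 ∷ 3 ∷ 10 ∷ 11 ∷ 0 ∷ 0 ∷ 3 ∷ 3 ∷ []))
    ∷ (70 , strategy (8 ∷ 4 ∷ 0 ∷ 0 ∷ 0 ∷ 0 ∷ 0 ∷ 2 ∷ 0 ∷ 1 ∷ 2 ∷ 2 ∷ 4 ∷ 0 ∷ 1 ∷ [])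
                     (3 ∷ 0 ∷ 3 ∷ 3 ∷ 3 ∷ 3 ∷ 3 ∷ 1 ∷ 3 ∷ 10 ∷ 1 ∷ 12 ∷ 0 ∷ 3 ∷ 7 ∷ []))
    ∷ (70 , strategy (0 ∷ 0 ∷ 0 ∷ 0 ∷ 16 ∷ 0 ∷ 0 ∷ 4 ∷ 0 ∷ 2 ∷ 4 ∷ 2 ∷ 1 ∷ 0 ∷ 8 ∷ [])
                     (3 ∷ 3 ∷ 3 ∷ 3 ∷ 3 ∷ 3 ∷ 3 ∷ 14 ∷ 3 ∷ 10 ∷ 14 ∷ 10 ∷ 11 ∷ 3 ∷ 4 ∷ []))
    ∷ (70 , strategy (0 ∷ 0 ∷ 0 ∷ 0 ∷ 8 ∷ 0 ∷ 0 ∷ 4 ∷ 0 ∷ 2 ∷ 0 ∷ 1 ∷ 2 ∷ 0 ∷ 2 ∷ [])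
                     (3 ∷ 3 ∷ 3 ∷ 3 ∷ 3 ∷ 3 ∷ 3 ∷ 4 ∷ 3 ∷ 7 ∷ 3 ∷ 12 ∷ 7 ∷ 3 ∷ 7 ∷ []))
    ∷ (105 , strategy (0 ∷ 2 ∷ 0 ∷ 0 ∷ 0 ∷ 0 ∷ 0 ∷ 1 ∷ 8 ∷ 4 ∷ 4 ∷ 1 ∷ 0 ∷ 0 ∷ 2 ∷ [])
                      (3 ∷ 10 ∷ 3 ∷ 3 ∷ 3 ∷ 3 ∷ 3 ∷ 1 ∷ 3 ∷ 8 ∷ 8 ∷ 1 ∷ 3 ∷ 3 ∷ 10 ∷ []))
    ∷ (315 , strategy (0 ∷ 0 ∷ 0 ∷ 0 ∷ 4 ∷ 2 ∷ 0 ∷ 2 ∷ 0 ∷ 1 ∷ 0 ∷ 0 ∷ 1 ∷ 0 ∷ 0 ∷ [])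
                      (3 ∷ 3 ∷ 3 ∷ 3 ∷ 3 ∷ 4 ∷ 3 ∷ 4 ∷ 3 ∷ 7 ∷ 3 ∷ 3 ∷ 5 ∷ 3 ∷ 3 ∷ []))
    ∷ (120 , strategy (2 ∷ 4 ∷ 32 ∷ 0 ∷ 2 ∷ 1 ∷ 16 ∷ 1 ∷ 4 ∷ 2 ∷ 8 ∷ 4 ∷ 2 ∷ 2 ∷ 4 ∷ [])
                      (1 ∷ 10 ∷ 3 ∷ 3 ∷ 14 ∷ 12 ∷ 2 ∷ 4 ∷ 10 ∷ 8 ∷ 6 ∷ 10 ∷ 11 ∷ 1 ∷ 10 ∷ []))
    ∷ (280 , strategy (0 ∷ 4 ∷ 0 ∷ 0 ∷ 0 ∷ 0 ∷ 0 ∷ 0 ∷ 0 ∷ 0 ∷ 2 ∷ 2 ∷ 1 ∷ 0 ∷ 1 ∷ [])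
                      (3 ∷ 3 ∷ 3 ∷ 3 ∷ 3 ∷ 3 ∷ 3 ∷ 3 ∷ 3 ∷ 3 ∷ 1 ∷ 1 ∷ 11 ∷ 3 ∷ 10 ∷ []))
    ∷ [])

certificate₄ : Certificate 15
certificate₄ =
  byStrategies 23472
    ( (396 , strategy (2 ∷ 2 ∷ 1 ∷ 2 ∷ 0 ∷ 4 ∷ 2 ∷ 16 ∷ 4 ∷ 8 ∷ 4 ∷ 4 ∷ 8 ∷ 2 ∷ 8 ∷ [])
                      (11 ∷ 10 ∷ 3 ∷ 8 ∷ 4 ∷ 12 ∷ 10 ∷ 4 ∷ 9 ∷ 7 ∷ 14 ∷ 12 ∷ 7 ∷ 5 ∷ 7 ∷ []))
    ∷ (3960 , strategy (0 ∷ 0 ∷ 0 ∷ 0 ∷ 0 ∷ 0 ∷ 0 ∷ 4 ∷ 0 ∷ 2 ∷ 0 ∷ 1 ∷ 2 ∷ 0 ∷ 0 ∷ [])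
                       (4 ∷ 4 ∷ 4 ∷ 4 ∷ 4 ∷ 4 ∷ 4 ∷ 4 ∷ 4 ∷ 7 ∷ 4 ∷ 12 ∷ 7 ∷ 4 ∷ 4 ∷ []))
    ∷ (360 , strategy (16 ∷ 4 ∷ 4 ∷ 8 ∷ 0 ∷ 32 ∷ 1 ∷ 8 ∷ 1 ∷ 1 ∷ 2 ∷ 8 ∷ 16 ∷ 16 ∷ 1 ∷ [])
                      (5 ∷ 7 ∷ 3 ∷ 0 ∷ 4 ∷ 4 ∷ 10 ∷ 13 ∷ 10 ∷ 10 ∷ 1 ∷ 12 ∷ 5 ∷ 5 ∷ 10 ∷ []))
    ∷ (2376 , strategy (0 ∷ 1 ∷ 2 ∷ 0 ∷ 0 ∷ 4 ∷ 1 ∷ 0 ∷ 2 ∷ 1 ∷ 0 ∷ 0 ∷ 0 ∷ 0 ∷ 0 ∷ [])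
                       (4 ∷ 2 ∷ 5 ∷ 4 ∷ 4 ∷ 4 ∷ 2 ∷ 4 ∷ 5 ∷ 8 ∷ 4 ∷ 4 ∷ 4 ∷ 4 ∷ 4 ∷ []))
    ∷ (880 , strategy (8 ∷ 4 ∷ 2 ∷ 0 ∷ 0 ∷ 0 ∷ 1 ∷ 0 ∷ 0 ∷ 0 ∷ 0 ∷ 2 ∷ 4 ∷ 2 ∷ 0 ∷ [])
                      (4 ∷ 0 ∷ 1 ∷ 4 ∷ 4 ∷ 4 ∷ 2 ∷ 4 ∷ 4 ∷ 4 ∷ 4 ∷ 12 ∷ 0 ∷ 1 ∷ 4 ∷ []))
    ∷ (330 , strategy (2 ∷ 2 ∷ 4 ∷ 0 ∷ 0 ∷ 8 ∷ 2 ∷ 0 ∷ 4 ∷ 0 ∷ 0 ∷ 1 ∷ 4 ∷ 4 ∷ 0 ∷ [])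
                      (12 ∷ 2 ∷ 5 ∷ 4 ∷ 4 ∷ 4 ∷ 2 ∷ 4 ∷ 5 ∷ 4 ∷ 4 ∷ 0 ∷ 5 ∷ 5 ∷ 4 ∷ []))
    ∷ (3465 , strategy (0 ∷ 0 ∷ 1 ∷ 0 ∷ 0 ∷ 0 ∷ 2 ∷ 0 ∷ 0 ∷ 0 ∷ 0 ∷ 0 ∷ 0 ∷ 0 ∷ 4 ∷ [])
                       (4 ∷ 4 ∷ 6 ∷ 4 ∷ 4 ∷ 4 ∷ 14 ∷ 4 ∷ 4 ∷ 4 ∷ 4 ∷ 4 ∷ 4 ∷ 4 ∷ 4 ∷ []))
    ∷ (880 , strategy (0 ∷ 4 ∷ 2 ∷ 0 ∷ 0 ∷ 0 ∷ 4 ∷ 0 ∷ 0 ∷ 4 ∷ 8 ∷ 2 ∷ 1 ∷ 2 ∷ 0 ∷ [])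
                      (4 ∷ 10 ∷ 1 ∷ 4 ∷ 4 ∷ 4 ∷ 10 ∷ 4 ∷ 4 ∷ 10 ∷ 4 ∷ 1 ∷ 11 ∷ 1 ∷ 4 ∷ []))
    ∷ (3630 , strategy (0 ∷ 2 ∷ 0 ∷ 0 ∷ 0 ∷ 0 ∷ 1 ∷ 0 ∷ 2 ∷ 2 ∷ 4 ∷ 2 ∷ 0 ∷ 1 ∷ 2 ∷ [])
                       (4 ∷ 10 ∷ 4 ∷ 4 ∷ 4 ∷ 4 ∷ 14 ∷ 4 ∷ 10 ∷ 10 ∷ 4 ∷ 10 ∷ 4 ∷ 1 ∷ 10 ∷ []))
    ∷ (2475 , strategy (4 ∷ 2 ∷ 4 ∷ 8 ∷ 0 ∷ 0 ∷ 2 ∷ 0 ∷ 4 ∷ 0 ∷ 0 ∷ 2 ∷ 1 ∷ 4 ∷ 0 ∷ [])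
                       (3 ∷ 0 ∷ 3 ∷ 4 ∷ 4 ∷ 4 ∷ 2 ∷ 4 ∷ 3 ∷ 4 ∷ 4 ∷ 0 ∷ 11 ∷ 3 ∷ 4 ∷ []))
    ∷ [])

certificate₅ : Certificate 15
certificate₅ =
  byStrategies 7316936
    ( (446160 , strategy (0 ∷ 4 ∷ 0 ∷ 2 ∷ 0 ∷ 0 ∷ 1 ∷ 8 ∷ 0 ∷ 0 ∷ 0 ∷ 2 ∷ 16 ∷ 0 ∷ 4 ∷ [])
                         (5 ∷ 7 ∷ 5 ∷ 1 ∷ 5 ∷ 5 ∷ 3 ∷ 12 ∷ 5 ∷ 5 ∷ 5 ∷ 1 ∷ 5 ∷ 5 ∷ 7 ∷ []))
    ∷ (269280 , strategy (0 ∷ 0 ∷ 0 ∷ 4 ∷ 0 ∷ 0 ∷ 2 ∷ 4 ∷ 0 ∷ 2 ∷ 0 ∷ 0 ∷ 0 ∷ 8 ∷ 1 ∷ [])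
                         (5 ∷ 5 ∷ 5 ∷ 13 ∷ 5 ∷ 5 ∷ 3 ∷ 13 ∷ 5 ∷ 7 ∷ 5 ∷ 5 ∷ 5 ∷ 5 ∷ 6 ∷ []))
    ∷ (44880 , strategy (4 ∷ 16 ∷ 32 ∷ 8 ∷ 2 ∷ 0 ∷ 4 ∷ 2 ∷ 4 ∷ 2 ∷ 1 ∷ 8 ∷ 2 ∷ 4 ∷ 1 ∷ [])
                        (3 ∷ 2 ∷ 5 ∷ 1 ∷ 0 ∷ 5 ∷ 3 ∷ 13 ∷ 3 ∷ 8 ∷ 4 ∷ 1 ∷ 0 ∷ 3 ∷ 4 ∷ []))
    ∷ (328185 , strategy (0 ∷ 0 ∷ 16 ∷ 4 ∷ 2 ∷ 0 ∷ 8 ∷ 0 ∷ 0 ∷ 2 ∷ 4 ∷ 2 ∷ 0 ∷ 0 ∷ 1 ∷ [])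
                         (5 ∷ 5 ∷ 5 ∷ 6 ∷ 3 ∷ 5 ∷ 2 ∷ 5 ∷ 5 ∷ 10 ∷ 6 ∷ 10 ∷ 5 ∷ 5 ∷ 4 ∷ []))
    ∷ (87516 , strategy (2 ∷ 4 ∷ 2 ∷ 8 ∷ 4 ∷ 0 ∷ 4 ∷ 2 ∷ 16 ∷ 4 ∷ 8 ∷ 4 ∷ 1 ∷ 4 ∷ 4 ∷ [])
                        (4 ∷ 3 ∷ 6 ∷ 8 ∷ 3 ∷ 5 ∷ 3 ∷ 4 ∷ 5 ∷ 10 ∷ 8 ∷ 10 ∷ 0 ∷ 3 ∷ 10 ∷ []))
    ∷ (145860 , strategy (2 ∷ 4 ∷ 2 ∷ 2 ∷ 4 ∷ 0 ∷ 1 ∷ 2 ∷ 16 ∷ 8 ∷ 8 ∷ 4 ∷ 1 ∷ 2 ∷ 1 ∷ [])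
                         (4 ∷ 10 ∷ 1 ∷ 1 ∷ 10 ∷ 5 ∷ 2 ∷ 4 ∷ 5 ∷ 8 ∷ 8 ∷ 10 ∷ 7 ∷ 1 ∷ 7 ∷ []))
    ∷ (583440 , strategy (0 ∷ 0 ∷ 0 ∷ 1 ∷ 8 ∷ 0 ∷ 2 ∷ 0 ∷ 0 ∷ 2 ∷ 4 ∷ 2 ∷ 0 ∷ 0 ∷ 4 ∷ [])
                         (5 ∷ 5 ∷ 5 ∷ 6 ∷ 5 ∷ 5 ∷ 14 ∷ 5 ∷ 5 ∷ 10 ∷ 4 ∷ 10 ∷ 5 ∷ 5 ∷ 4 ∷ []))
    ∷ (424320 , strategy (0 ∷ 0 ∷ 0 ∷ 0 ∷ 0 ∷ 0 ∷ 1 ∷ 4 ∷ 0 ∷ 2 ∷ 0 ∷ 0 ∷ 0 ∷ 8 ∷ 2 ∷ [])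
                         (5 ∷ 5 ∷ 5 ∷ 5 ∷ 5 ∷ 5 ∷ 14 ∷ 13 ∷ 5 ∷ 7 ∷ 5 ∷ 5 ∷ 5 ∷ 5 ∷ 7 ∷ []))
    ∷ (413270 , strategy (0 ∷ 0 ∷ 0 ∷ 4 ∷ 2 ∷ 0 ∷ 2 ∷ 0 ∷ 8 ∷ 4 ∷ 0 ∷ 0 ∷ 0 ∷ 0 ∷ 1 ∷ [])
                         (5 ∷ 5 ∷ 5 ∷ 8 ∷ 3 ∷ 5 ∷ 3 ∷ 5 ∷ 5 ∷ 8 ∷ 5 ∷ 5 ∷ 5 ∷ 5 ∷ 4 ∷ []))
    ∷ (424320 , strategy (16 ∷ 8 ∷ 0 ∷ 0 ∷ 0 ∷ 0 ∷ 1 ∷ 0 ∷ 0 ∷ 2 ∷ 4 ∷ 8 ∷ 0 ∷ 0 ∷ 2 ∷ [])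
                         (5 ∷ 0 ∷ 5 ∷ 5 ∷ 5 ∷ 5 ∷ 14 ∷ 5 ∷ 5 ∷ 10 ∷ 1 ∷ 0 ∷ 5 ∷ 5 ∷ 10 ∷ []))
    ∷ (24310 , strategy (2 ∷ 32 ∷ 8 ∷ 32 ∷ 16 ∷ 0 ∷ 16 ∷ 32 ∷ 4 ∷ 4 ∷ 8 ∷ 4 ∷ 1 ∷ 64 ∷ 4 ∷ [])
                        (11 ∷ 13 ∷ 6 ∷ 13 ∷ 3 ∷ 5 ∷ 3 ∷ 13 ∷ 10 ∷ 10 ∷ 6 ∷ 10 ∷ 0 ∷ 5 ∷ 10 ∷ []))
    ∷ [])

certificate₆ : Certificate 15
certificate₆ =
  byStrategies 95744
    ( (2288 , strategy (4 ∷ 0 ∷ 0 ∷ 0 ∷ 0 ∷ 2 ∷ 0 ∷ 4 ∷ 4 ∷ 8 ∷ 16 ∷ 8 ∷ 4 ∷ 1 ∷ 0 ∷ [])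
                       (11 ∷ 6 ∷ 6 ∷ 6 ∷ 6 ∷ 8 ∷ 6 ∷ 9 ∷ 9 ∷ 10 ∷ 6 ∷ 10 ∷ 11 ∷ 5 ∷ 6 ∷ []))
    ∷ (1001 , strategy (0 ∷ 0 ∷ 0 ∷ 0 ∷ 8 ∷ 2 ∷ 0 ∷ 8 ∷ 0 ∷ 0 ∷ 0 ∷ 0 ∷ 4 ∷ 1 ∷ 16 ∷ [])
                       (6 ∷ 6 ∷ 6 ∷ 6 ∷ 14 ∷ 12 ∷ 6 ∷ 14 ∷ 6 ∷ 6 ∷ 6 ∷ 6 ∷ 7 ∷ 5 ∷ 6 ∷ []))
    ∷ (9856 , strategy (2 ∷ 0 ∷ 0 ∷ 4 ∷ 0 ∷ 1 ∷ 0 ∷ 0 ∷ 2 ∷ 1 ∷ 0 ∷ 1 ∷ 1 ∷ 2 ∷ 0 ∷ [])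
                       (3 ∷ 6 ∷ 6 ∷ 6 ∷ 6 ∷ 8 ∷ 6 ∷ 6 ∷ 3 ∷ 8 ∷ 6 ∷ 0 ∷ 0 ∷ 3 ∷ 6 ∷ []))
    ∷ (11011 , strategy (0 ∷ 2 ∷ 4 ∷ 0 ∷ 0 ∷ 2 ∷ 0 ∷ 1 ∷ 0 ∷ 0 ∷ 0 ∷ 0 ∷ 1 ∷ 1 ∷ 0 ∷ [])
                        (6 ∷ 2 ∷ 6 ∷ 6 ∷ 6 ∷ 2 ∷ 6 ∷ 1 ∷ 6 ∷ 6 ∷ 6 ∷ 6 ∷ 5 ∷ 1 ∷ 6 ∷ []))
    ∷ (16016 , strategy (2 ∷ 2 ∷ 0 ∷ 4 ∷ 2 ∷ 1 ∷ 0 ∷ 1 ∷ 2 ∷ 1 ∷ 0 ∷ 1 ∷ 1 ∷ 2 ∷ 0 ∷ [])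
                        (3 ∷ 3 ∷ 6 ∷ 6 ∷ 3 ∷ 4 ∷ 6 ∷ 4 ∷ 3 ∷ 8 ∷ 6 ∷ 1 ∷ 0 ∷ 3 ∷ 6 ∷ []))
    ∷ (7392 , strategy (2 ∷ 0 ∷ 0 ∷ 0 ∷ 4 ∷ 1 ∷ 0 ∷ 0 ∷ 4 ∷ 4 ∷ 8 ∷ 4 ∷ 2 ∷ 0 ∷ 0 ∷ [])
                       (4 ∷ 6 ∷ 6 ∷ 6 ∷ 10 ∷ 0 ∷ 6 ∷ 6 ∷ 10 ∷ 10 ∷ 6 ∷ 10 ∷ 11 ∷ 6 ∷ 6 ∷ []))
    ∷ (4576 , strategy (2 ∷ 4 ∷ 8 ∷ 0 ∷ 2 ∷ 4 ∷ 0 ∷ 2 ∷ 2 ∷ 1 ∷ 0 ∷ 2 ∷ 2 ∷ 2 ∷ 0 ∷ [])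
                       (5 ∷ 2 ∷ 6 ∷ 6 ∷ 5 ∷ 2 ∷ 6 ∷ 1 ∷ 5 ∷ 8 ∷ 6 ∷ 1 ∷ 5 ∷ 5 ∷ 6 ∷ []))
    ∷ (9152 , strategy (1 ∷ 2 ∷ 0 ∷ 0 ∷ 2 ∷ 1 ∷ 0 ∷ 4 ∷ 0 ∷ 2 ∷ 0 ∷ 1 ∷ 2 ∷ 2 ∷ 8 ∷ [])
                       (4 ∷ 7 ∷ 6 ∷ 6 ∷ 7 ∷ 4 ∷ 6 ∷ 14 ∷ 6 ∷ 7 ∷ 6 ∷ 1 ∷ 7 ∷ 7 ∷ 6 ∷ []))
    ∷ (1232 , strategy (2 ∷ 1 ∷ 0 ∷ 0 ∷ 4 ∷ 0 ∷ 0 ∷ 4 ∷ 0 ∷ 0 ∷ 0 ∷ 1 ∷ 2 ∷ 2 ∷ 8 ∷ [])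
                       (4 ∷ 0 ∷ 6 ∷ 6 ∷ 14 ∷ 6 ∷ 6 ∷ 14 ∷ 6 ∷ 6 ∷ 6 ∷ 0 ∷ 7 ∷ 7 ∷ 6 ∷ []))
    ∷ (2912 , strategy (2 ∷ 4 ∷ 8 ∷ 0 ∷ 0 ∷ 4 ∷ 0 ∷ 2 ∷ 0 ∷ 1 ∷ 0 ∷ 2 ∷ 2 ∷ 2 ∷ 0 ∷ [])
                       (1 ∷ 2 ∷ 6 ∷ 6 ∷ 6 ∷ 2 ∷ 6 ∷ 1 ∷ 6 ∷ 7 ∷ 6 ∷ 1 ∷ 5 ∷ 1 ∷ 6 ∷ []))
    ∷ [])

certificate₇ : Certificate 15
certificate₇ =
  byStrategies 1207388
    ( (62700 , strategy (1 ∷ 0 ∷ 2 ∷ 0 ∷ 0 ∷ 0 ∷ 4 ∷ 0 ∷ 2 ∷ 0 ∷ 4 ∷ 2 ∷ 0 ∷ 0 ∷ 8 ∷ [])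
                        (11 ∷ 7 ∷ 6 ∷ 7 ∷ 7 ∷ 7 ∷ 14 ∷ 7 ∷ 10 ∷ 7 ∷ 14 ∷ 10 ∷ 7 ∷ 7 ∷ 7 ∷ []))
    ∷ (73920 , strategy (4 ∷ 0 ∷ 2 ∷ 0 ∷ 0 ∷ 4 ∷ 1 ∷ 0 ∷ 0 ∷ 0 ∷ 2 ∷ 4 ∷ 8 ∷ 0 ∷ 0 ∷ [])
                        (12 ∷ 7 ∷ 5 ∷ 7 ∷ 7 ∷ 12 ∷ 10 ∷ 7 ∷ 7 ∷ 7 ∷ 11 ∷ 12 ∷ 7 ∷ 7 ∷ 7 ∷ []))
    ∷ (15960 , strategy (8 ∷ 4 ∷ 2 ∷ 2 ∷ 16 ∷ 8 ∷ 4 ∷ 0 ∷ 4 ∷ 2 ∷ 1 ∷ 2 ∷ 4 ∷ 1 ∷ 8 ∷ [])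
                        (4 ∷ 0 ∷ 6 ∷ 1 ∷ 7 ∷ 4 ∷ 14 ∷ 7 ∷ 5 ∷ 8 ∷ 11 ∷ 1 ∷ 5 ∷ 3 ∷ 4 ∷ []))
    ∷ (7315 , strategy (4 ∷ 4 ∷ 4 ∷ 8 ∷ 4 ∷ 8 ∷ 4 ∷ 0 ∷ 16 ∷ 32 ∷ 8 ∷ 2 ∷ 1 ∷ 2 ∷ 4 ∷ [])
                       (3 ∷ 3 ∷ 5 ∷ 8 ∷ 3 ∷ 8 ∷ 3 ∷ 7 ∷ 9 ∷ 7 ∷ 8 ∷ 1 ∷ 11 ∷ 1 ∷ 10 ∷ []))
    ∷ (12540 , strategy (8 ∷ 16 ∷ 2 ∷ 4 ∷ 0 ∷ 0 ∷ 1 ∷ 0 ∷ 2 ∷ 0 ∷ 1 ∷ 0 ∷ 0 ∷ 0 ∷ 0 ∷ [])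
                        (1 ∷ 7 ∷ 3 ∷ 0 ∷ 7 ∷ 7 ∷ 2 ∷ 7 ∷ 3 ∷ 7 ∷ 8 ∷ 7 ∷ 7 ∷ 7 ∷ 7 ∷ []))
    ∷ (7315 , strategy (2 ∷ 8 ∷ 1 ∷ 2 ∷ 4 ∷ 32 ∷ 4 ∷ 0 ∷ 4 ∷ 8 ∷ 16 ∷ 32 ∷ 64 ∷ 4 ∷ 8 ∷ [])
                       (4 ∷ 10 ∷ 3 ∷ 4 ∷ 14 ∷ 12 ∷ 14 ∷ 7 ∷ 9 ∷ 10 ∷ 11 ∷ 12 ∷ 7 ∷ 1 ∷ 10 ∷ []))
    ∷ (27720 , strategy (4 ∷ 0 ∷ 2 ∷ 4 ∷ 8 ∷ 2 ∷ 2 ∷ 0 ∷ 1 ∷ 0 ∷ 4 ∷ 0 ∷ 0 ∷ 0 ∷ 0 ∷ [])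
                        (4 ∷ 7 ∷ 3 ∷ 4 ∷ 7 ∷ 0 ∷ 3 ∷ 7 ∷ 5 ∷ 7 ∷ 4 ∷ 7 ∷ 7 ∷ 7 ∷ 7 ∷ []))
    ∷ (27720 , strategy (2 ∷ 0 ∷ 1 ∷ 2 ∷ 16 ∷ 8 ∷ 4 ∷ 0 ∷ 4 ∷ 0 ∷ 8 ∷ 4 ∷ 0 ∷ 0 ∷ 0 ∷ [])
                        (11 ∷ 7 ∷ 3 ∷ 8 ∷ 7 ∷ 4 ∷ 10 ∷ 7 ∷ 5 ∷ 7 ∷ 4 ∷ 10 ∷ 7 ∷ 7 ∷ 7 ∷ []))
    ∷ (7315 , strategy (8 ∷ 4 ∷ 16 ∷ 16 ∷ 8 ∷ 8 ∷ 32 ∷ 0 ∷ 2 ∷ 1 ∷ 4 ∷ 2 ∷ 4 ∷ 8 ∷ 64 ∷ [])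
                       (3 ∷ 0 ∷ 6 ∷ 6 ∷ 3 ∷ 2 ∷ 14 ∷ 7 ∷ 10 ∷ 8 ∷ 4 ∷ 1 ∷ 0 ∷ 3 ∷ 7 ∷ []))
    ∷ (175560 , strategy (1 ∷ 0 ∷ 1 ∷ 2 ∷ 0 ∷ 0 ∷ 1 ∷ 0 ∷ 1 ∷ 0 ∷ 0 ∷ 0 ∷ 0 ∷ 4 ∷ 0 ∷ [])
                         (3 ∷ 7 ∷ 3 ∷ 13 ∷ 7 ∷ 7 ∷ 3 ∷ 7 ∷ 3 ∷ 7 ∷ 7 ∷ 7 ∷ 7 ∷ 7 ∷ 7 ∷ []))
    ∷ (43890 , strategy (1 ∷ 16 ∷ 8 ∷ 4 ∷ 2 ∷ 4 ∷ 2 ∷ 0 ∷ 2 ∷ 1 ∷ 1 ∷ 8 ∷ 4 ∷ 8 ∷ 1 ∷ [])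
                        (4 ∷ 7 ∷ 1 ∷ 2 ∷ 5 ∷ 2 ∷ 3 ∷ 7 ∷ 5 ∷ 8 ∷ 8 ∷ 1 ∷ 11 ∷ 1 ∷ 4 ∷ []))
    ∷ (7315 , strategy (4 ∷ 16 ∷ 4 ∷ 8 ∷ 4 ∷ 2 ∷ 2 ∷ 0 ∷ 4 ∷ 2 ∷ 2 ∷ 8 ∷ 1 ∷ 4 ∷ 2 ∷ [])
                       (11 ∷ 7 ∷ 3 ∷ 1 ∷ 3 ∷ 4 ∷ 2 ∷ 7 ∷ 3 ∷ 8 ∷ 4 ∷ 1 ∷ 5 ∷ 3 ∷ 4 ∷ []))
    ∷ (26334 , strategy (4 ∷ 2 ∷ 4 ∷ 8 ∷ 2 ∷ 2 ∷ 4 ∷ 0 ∷ 16 ∷ 32 ∷ 8 ∷ 2 ∷ 1 ∷ 1 ∷ 2 ∷ [])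
                        (3 ∷ 2 ∷ 3 ∷ 8 ∷ 0 ∷ 2 ∷ 3 ∷ 7 ∷ 9 ∷ 7 ∷ 8 ∷ 0 ∷ 11 ∷ 1 ∷ 6 ∷ []))
    ∷ [])

certificate₈ : Certificate 15
certificate₈ =
  byStrategies 7440
    ( (105 , strategy (1 ∷ 4 ∷ 0 ∷ 0 ∷ 0 ∷ 0 ∷ 0 ∷ 8 ∷ 0 ∷ 16 ∷ 0 ∷ 2 ∷ 4 ∷ 4 ∷ 4 ∷ [])
                      (11 ∷ 7 ∷ 8 ∷ 8 ∷ 8 ∷ 8 ∷ 8 ∷ 9 ∷ 8 ∷ 8 ∷ 8 ∷ 1 ∷ 7 ∷ 7 ∷ 7 ∷ []))
    ∷ (105 , strategy (2 ∷ 4 ∷ 2 ∷ 8 ∷ 4 ∷ 0 ∷ 0 ∷ 2 ∷ 0 ∷ 0 ∷ 0 ∷ 2 ∷ 1 ∷ 2 ∷ 2 ∷ [])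
                      (1 ∷ 3 ∷ 1 ∷ 8 ∷ 3 ∷ 8 ∷ 8 ∷ 4 ∷ 8 ∷ 8 ∷ 8 ∷ 1 ∷ 7 ∷ 1 ∷ 4 ∷ []))
    ∷ (896 , strategy (2 ∷ 1 ∷ 2 ∷ 0 ∷ 2 ∷ 4 ∷ 0 ∷ 1 ∷ 0 ∷ 0 ∷ 0 ∷ 1 ∷ 2 ∷ 2 ∷ 1 ∷ [])
                      (5 ∷ 0 ∷ 5 ∷ 8 ∷ 5 ∷ 8 ∷ 8 ∷ 4 ∷ 8 ∷ 8 ∷ 8 ∷ 12 ∷ 5 ∷ 5 ∷ 4 ∷ []))
    ∷ (1050 , strategy (2 ∷ 2 ∷ 2 ∷ 4 ∷ 2 ∷ 0 ∷ 2 ∷ 1 ∷ 0 ∷ 0 ∷ 0 ∷ 1 ∷ 1 ∷ 2 ∷ 1 ∷ [])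
                       (3 ∷ 3 ∷ 3 ∷ 8 ∷ 3 ∷ 8 ∷ 3 ∷ 4 ∷ 8 ∷ 8 ∷ 8 ∷ 0 ∷ 0 ∷ 3 ∷ 6 ∷ []))
    ∷ (360 , strategy (0 ∷ 0 ∷ 2 ∷ 0 ∷ 2 ∷ 4 ∷ 1 ∷ 0 ∷ 0 ∷ 0 ∷ 0 ∷ 1 ∷ 2 ∷ 0 ∷ 1 ∷ [])
                      (8 ∷ 8 ∷ 5 ∷ 8 ∷ 5 ∷ 8 ∷ 2 ∷ 8 ∷ 8 ∷ 8 ∷ 8 ∷ 12 ∷ 5 ∷ 8 ∷ 4 ∷ []))
    ∷ (105 , strategy (1 ∷ 2 ∷ 1 ∷ 0 ∷ 0 ∷ 0 ∷ 0 ∷ 0 ∷ 0 ∷ 0 ∷ 4 ∷ 2 ∷ 1 ∷ 1 ∷ 2 ∷ [])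
                      (1 ∷ 10 ∷ 1 ∷ 8 ∷ 8 ∷ 8 ∷ 8 ∷ 8 ∷ 8 ∷ 8 ∷ 8 ∷ 10 ∷ 11 ∷ 1 ∷ 10 ∷ []))
    ∷ (840 , strategy (1 ∷ 2 ∷ 1 ∷ 0 ∷ 0 ∷ 0 ∷ 0 ∷ 4 ∷ 0 ∷ 8 ∷ 0 ∷ 0 ∷ 2 ∷ 2 ∷ 2 ∷ [])
                      (12 ∷ 7 ∷ 1 ∷ 8 ∷ 8 ∷ 8 ∷ 8 ∷ 9 ∷ 8 ∷ 8 ∷ 8 ∷ 8 ∷ 7 ∷ 7 ∷ 7 ∷ []))
    ∷ (448 , strategy (0 ∷ 1 ∷ 0 ∷ 0 ∷ 4 ∷ 0 ∷ 4 ∷ 2 ∷ 0 ∷ 0 ∷ 8 ∷ 4 ∷ 2 ∷ 0 ∷ 1 ∷ [])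
                      (8 ∷ 7 ∷ 8 ∷ 8 ∷ 10 ∷ 8 ∷ 10 ∷ 4 ∷ 8 ∷ 8 ∷ 8 ∷ 10 ∷ 11 ∷ 8 ∷ 7 ∷ []))
    ∷ (600 , strategy (2 ∷ 2 ∷ 2 ∷ 4 ∷ 0 ∷ 0 ∷ 2 ∷ 1 ∷ 0 ∷ 0 ∷ 0 ∷ 1 ∷ 1 ∷ 2 ∷ 1 ∷ [])
                      (3 ∷ 3 ∷ 3 ∷ 8 ∷ 8 ∷ 8 ∷ 3 ∷ 13 ∷ 8 ∷ 8 ∷ 8 ∷ 0 ∷ 0 ∷ 3 ∷ 6 ∷ []))
    ∷ (105 , strategy (8 ∷ 4 ∷ 0 ∷ 0 ∷ 4 ∷ 16 ∷ 1 ∷ 0 ∷ 0 ∷ 0 ∷ 2 ∷ 4 ∷ 0 ∷ 0 ∷ 1 ∷ [])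
                      (5 ∷ 0 ∷ 8 ∷ 8 ∷ 0 ∷ 8 ∷ 10 ∷ 8 ∷ 8 ∷ 8 ∷ 4 ∷ 0 ∷ 8 ∷ 8 ∷ 10 ∷ []))
    ∷ (1680 , strategy (0 ∷ 0 ∷ 0 ∷ 0 ∷ 0 ∷ 0 ∷ 1 ∷ 0 ∷ 0 ∷ 0 ∷ 2 ∷ 1 ∷ 0 ∷ 0 ∷ 1 ∷ [])
                       (8 ∷ 8 ∷ 8 ∷ 8 ∷ 8 ∷ 8 ∷ 10 ∷ 8 ∷ 8 ∷ 8 ∷ 8 ∷ 10 ∷ 8 ∷ 8 ∷ 10 ∷ []))
    ∷ (105 , strategy (4 ∷ 0 ∷ 4 ∷ 0 ∷ 2 ∷ 8 ∷ 2 ∷ 0 ∷ 0 ∷ 0 ∷ 0 ∷ 2 ∷ 2 ∷ 0 ∷ 1 ∷ [])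
                      (5 ∷ 8 ∷ 5 ∷ 8 ∷ 0 ∷ 8 ∷ 2 ∷ 8 ∷ 8 ∷ 8 ∷ 8 ∷ 0 ∷ 0 ∷ 8 ∷ 4 ∷ []))
    ∷ (105 , strategy (4 ∷ 1 ∷ 4 ∷ 0 ∷ 2 ∷ 8 ∷ 0 ∷ 1 ∷ 0 ∷ 0 ∷ 0 ∷ 2 ∷ 4 ∷ 4 ∷ 1 ∷ [])
                      (5 ∷ 11 ∷ 5 ∷ 8 ∷ 0 ∷ 8 ∷ 8 ∷ 4 ∷ 8 ∷ 8 ∷ 8 ∷ 12 ∷ 5 ∷ 5 ∷ 4 ∷ []))
    ∷ [])

certificate₉ : Certificate 15
certificate₉ =
  split (# 8)
    (split (# 10)
      (split (# 7)
        (split (# 1)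
          (byStrategies 37
            ( (3 , strategy (1 ∷ 0 ∷ 1 ∷ 0 ∷ 1 ∷ 2 ∷ 0 ∷ 0 ∷ 4 ∷ 0 ∷ 0 ∷ 0 ∷ 1 ∷ 1 ∷ 0 ∷ [])
                            (5 ∷ 9 ∷ 5 ∷ 9 ∷ 5 ∷ 8 ∷ 9 ∷ 9 ∷ 9 ∷ 9 ∷ 9 ∷ 9 ∷ 5 ∷ 5 ∷ 9 ∷ []))
            ∷ (3 , strategy (2 ∷ 0 ∷ 2 ∷ 4 ∷ 2 ∷ 0 ∷ 0 ∷ 0 ∷ 8 ∷ 0 ∷ 0 ∷ 0 ∷ 1 ∷ 2 ∷ 0 ∷ [])
                            (3 ∷ 9 ∷ 3 ∷ 8 ∷ 3 ∷ 9 ∷ 9 ∷ 9 ∷ 9 ∷ 9 ∷ 9 ∷ 9 ∷ 0 ∷ 3 ∷ 9 ∷ []))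
            ∷ (3 , strategy (1 ∷ 0 ∷ 1 ∷ 1 ∷ 2 ∷ 1 ∷ 2 ∷ 0 ∷ 0 ∷ 0 ∷ 4 ∷ 2 ∷ 1 ∷ 0 ∷ 2 ∷ [])
                            (4 ∷ 9 ∷ 6 ∷ 4 ∷ 10 ∷ 4 ∷ 10 ∷ 9 ∷ 9 ∷ 9 ∷ 9 ∷ 10 ∷ 11 ∷ 9 ∷ 10 ∷ []))
            ∷ (2 , strategy (0 ∷ 0 ∷ 2 ∷ 2 ∷ 1 ∷ 0 ∷ 4 ∷ 0 ∷ 0 ∷ 0 ∷ 8 ∷ 4 ∷ 0 ∷ 1 ∷ 4 ∷ [])
                            (9 ∷ 9 ∷ 6 ∷ 6 ∷ 3 ∷ 9 ∷ 10 ∷ 9 ∷ 9 ∷ 9 ∷ 9 ∷ 10 ∷ 9 ∷ 3 ∷ 10 ∷ []))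
            ∷ (3 , strategy (2 ∷ 0 ∷ 1 ∷ 0 ∷ 0 ∷ 0 ∷ 2 ∷ 8 ∷ 0 ∷ 0 ∷ 0 ∷ 2 ∷ 4 ∷ 4 ∷ 4 ∷ [])
                            (12 ∷ 9 ∷ 6 ∷ 9 ∷ 9 ∷ 9 ∷ 14 ∷ 9 ∷ 9 ∷ 9 ∷ 9 ∷ 12 ∷ 7 ∷ 7 ∷ 7 ∷ []))
            ∷ (6 , strategy (1 ∷ 0 ∷ 1 ∷ 0 ∷ 2 ∷ 0 ∷ 2 ∷ 0 ∷ 0 ∷ 0 ∷ 4 ∷ 2 ∷ 1 ∷ 0 ∷ 2 ∷ [])
                            (11 ∷ 9 ∷ 6 ∷ 9 ∷ 10 ∷ 9 ∷ 10 ∷ 9 ∷ 9 ∷ 9 ∷ 9 ∷ 10 ∷ 11 ∷ 9 ∷ 10 ∷ []))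
            ∷ (3 , strategy (2 ∷ 0 ∷ 2 ∷ 4 ∷ 2 ∷ 4 ∷ 0 ∷ 0 ∷ 8 ∷ 0 ∷ 0 ∷ 1 ∷ 2 ∷ 2 ∷ 0 ∷ [])
                            (3 ∷ 9 ∷ 3 ∷ 8 ∷ 5 ∷ 8 ∷ 9 ∷ 9 ∷ 9 ∷ 9 ∷ 9 ∷ 0 ∷ 5 ∷ 5 ∷ 9 ∷ []))
            ∷ (2 , strategy (2 ∷ 0 ∷ 2 ∷ 4 ∷ 2 ∷ 4 ∷ 2 ∷ 0 ∷ 8 ∷ 0 ∷ 0 ∷ 1 ∷ 0 ∷ 2 ∷ 0 ∷ [])
                            (5 ∷ 9 ∷ 3 ∷ 8 ∷ 5 ∷ 8 ∷ 3 ∷ 9 ∷ 9 ∷ 9 ∷ 9 ∷ 0 ∷ 9 ∷ 5 ∷ 9 ∷ []))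
            ∷ (2 , strategy (2 ∷ 0 ∷ 2 ∷ 0 ∷ 0 ∷ 4 ∷ 1 ∷ 0 ∷ 8 ∷ 0 ∷ 0 ∷ 1 ∷ 2 ∷ 2 ∷ 0 ∷ [])
                            (5 ∷ 9 ∷ 5 ∷ 9 ∷ 9 ∷ 8 ∷ 2 ∷ 9 ∷ 9 ∷ 9 ∷ 9 ∷ 0 ∷ 5 ∷ 5 ∷ 9 ∷ []))
            ∷ []))
          (split (# 1)
            (split (# 3)
              (byStrategies 62
                ( (3 , strategy (4 ∷ 0 ∷ 4 ∷ 0 ∷ 8 ∷ 0 ∷ 8 ∷ 0 ∷ 0 ∷ 0 ∷ 16 ∷ 2 ∷ 1 ∷ 0 ∷ 0 ∷ [])
                                (4 ∷ 9 ∷ 6 ∷ 9 ∷ 10 ∷ 9 ∷ 10 ∷ 9 ∷ 9 ∷ 9 ∷ 9 ∷ 0 ∷ 11 ∷ 9 ∷ 9 ∷ []))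
                ∷ (3 , strategy (1 ∷ 2 ∷ 1 ∷ 0 ∷ 2 ∷ 0 ∷ 2 ∷ 0 ∷ 0 ∷ 0 ∷ 4 ∷ 2 ∷ 0 ∷ 1 ∷ 2 ∷ [])
                                (4 ∷ 10 ∷ 6 ∷ 9 ∷ 10 ∷ 9 ∷ 10 ∷ 9 ∷ 9 ∷ 9 ∷ 9 ∷ 10 ∷ 9 ∷ 1 ∷ 10 ∷ []))
                ∷ (4 , strategy (1 ∷ 2 ∷ 1 ∷ 0 ∷ 2 ∷ 1 ∷ 1 ∷ 4 ∷ 0 ∷ 0 ∷ 0 ∷ 0 ∷ 2 ∷ 2 ∷ 2 ∷ [])
                                (1 ∷ 7 ∷ 1 ∷ 9 ∷ 7 ∷ 12 ∷ 14 ∷ 9 ∷ 9 ∷ 9 ∷ 9 ∷ 9 ∷ 7 ∷ 7 ∷ 7 ∷ []))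
                ∷ (12 , strategy (1 ∷ 2 ∷ 1 ∷ 0 ∷ 2 ∷ 1 ∷ 2 ∷ 0 ∷ 0 ∷ 0 ∷ 4 ∷ 2 ∷ 1 ∷ 1 ∷ 2 ∷ [])
                                 (11 ∷ 10 ∷ 1 ∷ 9 ∷ 10 ∷ 4 ∷ 10 ∷ 9 ∷ 9 ∷ 9 ∷ 9 ∷ 10 ∷ 11 ∷ 1 ∷ 10 ∷ []))
                ∷ (8 , strategy (1 ∷ 2 ∷ 1 ∷ 0 ∷ 0 ∷ 0 ∷ 1 ∷ 4 ∷ 0 ∷ 0 ∷ 0 ∷ 1 ∷ 2 ∷ 2 ∷ 2 ∷ [])
                                (1 ∷ 7 ∷ 1 ∷ 9 ∷ 9 ∷ 9 ∷ 14 ∷ 9 ∷ 9 ∷ 9 ∷ 9 ∷ 1 ∷ 7 ∷ 7 ∷ 7 ∷ []))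
                ∷ (4 , strategy (1 ∷ 2 ∷ 1 ∷ 0 ∷ 2 ∷ 0 ∷ 1 ∷ 0 ∷ 0 ∷ 0 ∷ 4 ∷ 2 ∷ 0 ∷ 0 ∷ 2 ∷ [])
                                (1 ∷ 10 ∷ 1 ∷ 9 ∷ 10 ∷ 9 ∷ 14 ∷ 9 ∷ 9 ∷ 9 ∷ 9 ∷ 10 ∷ 9 ∷ 9 ∷ 10 ∷ []))
                ∷ (12 , strategy (2 ∷ 0 ∷ 2 ∷ 0 ∷ 0 ∷ 4 ∷ 0 ∷ 0 ∷ 8 ∷ 0 ∷ 0 ∷ 1 ∷ 2 ∷ 2 ∷ 0 ∷ [])
                                 (5 ∷ 9 ∷ 5 ∷ 9 ∷ 9 ∷ 8 ∷ 9 ∷ 9 ∷ 9 ∷ 9 ∷ 9 ∷ 0 ∷ 5 ∷ 5 ∷ 9 ∷ []))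
                ∷ []))
              (split (# 3)
                (split (# 4)
                  (byStrategies 4
                    ( (1 , strategy (1 ∷ 2 ∷ 1 ∷ 0 ∷ 0 ∷ 0 ∷ 2 ∷ 0 ∷ 0 ∷ 0 ∷ 4 ∷ 2 ∷ 0 ∷ 0 ∷ 2 ∷ [])
                                    (1 ∷ 10 ∷ 1 ∷ 9 ∷ 9 ∷ 9 ∷ 10 ∷ 9 ∷ 9 ∷ 9 ∷ 9 ∷ 10 ∷ 9 ∷ 9 ∷ 10 ∷ []))
                    ∷ (1 , strategy (2 ∷ 0 ∷ 2 ∷ 0 ∷ 0 ∷ 4 ∷ 1 ∷ 0 ∷ 8 ∷ 0 ∷ 0 ∷ 1 ∷ 2 ∷ 2 ∷ 0 ∷ [])
                                    (5 ∷ 9 ∷ 5 ∷ 9 ∷ 9 ∷ 8 ∷ 2 ∷ 9 ∷ 9 ∷ 9 ∷ 9 ∷ 0 ∷ 5 ∷ 5 ∷ 9 ∷ []))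
                    ∷ (1 , strategy (1 ∷ 2 ∷ 1 ∷ 0 ∷ 0 ∷ 0 ∷ 1 ∷ 4 ∷ 0 ∷ 0 ∷ 0 ∷ 1 ∷ 2 ∷ 2 ∷ 2 ∷ [])
                                    (1 ∷ 7 ∷ 1 ∷ 9 ∷ 9 ∷ 9 ∷ 14 ∷ 9 ∷ 9 ∷ 9 ∷ 9 ∷ 1 ∷ 7 ∷ 7 ∷ 7 ∷ []))
                    ∷ []))
                  (split (# 4)
                    (split (# 5)
                      (byStrategies 6
                        ( (1 , strategy (2 ∷ 0 ∷ 2 ∷ 4 ∷ 2 ∷ 0 ∷ 0 ∷ 0 ∷ 8 ∷ 0 ∷ 0 ∷ 0 ∷ 1 ∷ 2 ∷ 0 ∷ [])
                                        (3 ∷ 9 ∷ 3 ∷ 8 ∷ 3 ∷ 9 ∷ 9 ∷ 9 ∷ 9 ∷ 9 ∷ 9 ∷ 9 ∷ 0 ∷ 3 ∷ 9 ∷ []))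
                        ∷ (1 , strategy (1 ∷ 2 ∷ 1 ∷ 0 ∷ 2 ∷ 0 ∷ 2 ∷ 0 ∷ 0 ∷ 0 ∷ 4 ∷ 2 ∷ 0 ∷ 1 ∷ 2 ∷ [])
                                        (4 ∷ 10 ∷ 6 ∷ 9 ∷ 10 ∷ 9 ∷ 10 ∷ 9 ∷ 9 ∷ 9 ∷ 9 ∷ 10 ∷ 9 ∷ 1 ∷ 10 ∷ []))
                        ∷ (1 , strategy (1 ∷ 2 ∷ 1 ∷ 0 ∷ 0 ∷ 0 ∷ 2 ∷ 0 ∷ 0 ∷ 0 ∷ 4 ∷ 2 ∷ 1 ∷ 1 ∷ 0 ∷ [])
                                        (1 ∷ 10 ∷ 1 ∷ 9 ∷ 9 ∷ 9 ∷ 10 ∷ 9 ∷ 9 ∷ 9 ∷ 9 ∷ 10 ∷ 11 ∷ 1 ∷ 9 ∷ []))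
                        ∷ (1 , strategy (1 ∷ 2 ∷ 1 ∷ 0 ∷ 0 ∷ 0 ∷ 1 ∷ 4 ∷ 0 ∷ 0 ∷ 0 ∷ 1 ∷ 2 ∷ 2 ∷ 2 ∷ [])
                                        (1 ∷ 7 ∷ 1 ∷ 9 ∷ 9 ∷ 9 ∷ 14 ∷ 9 ∷ 9 ∷ 9 ∷ 9 ∷ 1 ∷ 7 ∷ 7 ∷ 7 ∷ []))
                        ∷ (1 , strategy (1 ∷ 2 ∷ 1 ∷ 0 ∷ 0 ∷ 0 ∷ 1 ∷ 4 ∷ 0 ∷ 0 ∷ 0 ∷ 1 ∷ 2 ∷ 0 ∷ 2 ∷ [])
                                        (12 ∷ 7 ∷ 1 ∷ 9 ∷ 9 ∷ 9 ∷ 14 ∷ 9 ∷ 9 ∷ 9 ∷ 9 ∷ 12 ∷ 7 ∷ 9 ∷ 7 ∷ []))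
                        ∷ []))
                      (split (# 5)
                        (split (# 6)
                          (byStrategies 40
                            ( (12 , strategy (1 ∷ 2 ∷ 1 ∷ 1 ∷ 2 ∷ 1 ∷ 0 ∷ 0 ∷ 0 ∷ 0 ∷ 4 ∷ 2 ∷ 1 ∷ 0 ∷ 2 ∷ [])
                                             (11 ∷ 10 ∷ 1 ∷ 1 ∷ 10 ∷ 4 ∷ 9 ∷ 9 ∷ 9 ∷ 9 ∷ 9 ∷ 10 ∷ 11 ∷ 9 ∷ 10 ∷ []))
                            ∷ (8 , strategy (2 ∷ 0 ∷ 2 ∷ 4 ∷ 2 ∷ 4 ∷ 0 ∷ 0 ∷ 8 ∷ 0 ∷ 0 ∷ 1 ∷ 2 ∷ 2 ∷ 0 ∷ [])
                                            (3 ∷ 9 ∷ 3 ∷ 8 ∷ 5 ∷ 8 ∷ 9 ∷ 9 ∷ 9 ∷ 9 ∷ 9 ∷ 0 ∷ 5 ∷ 5 ∷ 9 ∷ []))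
                            ∷ (6 , strategy (1 ∷ 2 ∷ 1 ∷ 0 ∷ 0 ∷ 0 ∷ 0 ∷ 4 ∷ 0 ∷ 0 ∷ 0 ∷ 1 ∷ 2 ∷ 2 ∷ 2 ∷ [])
                                            (12 ∷ 7 ∷ 1 ∷ 9 ∷ 9 ∷ 9 ∷ 9 ∷ 9 ∷ 9 ∷ 9 ∷ 9 ∷ 12 ∷ 7 ∷ 7 ∷ 7 ∷ []))
                            ∷ (3 , strategy (1 ∷ 2 ∷ 1 ∷ 0 ∷ 2 ∷ 0 ∷ 0 ∷ 4 ∷ 0 ∷ 0 ∷ 0 ∷ 0 ∷ 0 ∷ 2 ∷ 2 ∷ [])
                                            (4 ∷ 7 ∷ 1 ∷ 9 ∷ 7 ∷ 9 ∷ 9 ∷ 9 ∷ 9 ∷ 9 ∷ 9 ∷ 9 ∷ 9 ∷ 7 ∷ 7 ∷ []))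
                            ∷ (3 , strategy (2 ∷ 4 ∷ 2 ∷ 0 ∷ 0 ∷ 0 ∷ 0 ∷ 8 ∷ 0 ∷ 0 ∷ 0 ∷ 1 ∷ 0 ∷ 4 ∷ 0 ∷ [])
                                            (1 ∷ 7 ∷ 1 ∷ 9 ∷ 9 ∷ 9 ∷ 9 ∷ 9 ∷ 9 ∷ 9 ∷ 9 ∷ 0 ∷ 9 ∷ 7 ∷ 9 ∷ []))
                            ∷ []))
                          (split (# 6)
                            (split (# 11)
                              (byStrategies 16
                                ( (8 , strategy (1 ∷ 2 ∷ 1 ∷ 0 ∷ 2 ∷ 1 ∷ 1 ∷ 4 ∷ 0 ∷ 0 ∷ 0 ∷ 0 ∷ 2 ∷ 2 ∷ 2 ∷ [])
                                                (1 ∷ 7 ∷ 1 ∷ 9 ∷ 7 ∷ 12 ∷ 14 ∷ 9 ∷ 9 ∷ 9 ∷ 9 ∷ 9 ∷ 7 ∷ 7 ∷ 7 ∷ []))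
                                ∷ (1 , strategy (8 ∷ 0 ∷ 8 ∷ 4 ∷ 0 ∷ 16 ∷ 2 ∷ 0 ∷ 32 ∷ 0 ∷ 0 ∷ 0 ∷ 0 ∷ 0 ∷ 1 ∷ [])
                                                (5 ∷ 9 ∷ 5 ∷ 2 ∷ 9 ∷ 8 ∷ 3 ∷ 9 ∷ 9 ∷ 9 ∷ 9 ∷ 9 ∷ 9 ∷ 9 ∷ 6 ∷ []))
                                ∷ []))
                              (split (# 11)
                                (split (# 12)
                                  (byStrategies 8
                                    ( (1 , strategy (4 ∷ 0 ∷ 4 ∷ 0 ∷ 8 ∷ 2 ∷ 8 ∷ 0 ∷ 0 ∷ 0 ∷ 16 ∷ 0 ∷ 0 ∷ 1 ∷ 8 ∷ [])
                                                    (4 ∷ 9 ∷ 6 ∷ 9 ∷ 10 ∷ 2 ∷ 10 ∷ 9 ∷ 9 ∷ 9 ∷ 9 ∷ 9 ∷ 9 ∷ 5 ∷ 10 ∷ []))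
                                    ∷ (2 , strategy (2 ∷ 4 ∷ 2 ∷ 0 ∷ 0 ∷ 0 ∷ 0 ∷ 8 ∷ 0 ∷ 0 ∷ 0 ∷ 1 ∷ 0 ∷ 4 ∷ 0 ∷ [])
                                                    (1 ∷ 7 ∷ 1 ∷ 9 ∷ 9 ∷ 9 ∷ 9 ∷ 9 ∷ 9 ∷ 9 ∷ 9 ∷ 0 ∷ 9 ∷ 7 ∷ 9 ∷ []))
                                    ∷ []))
                                  (split (# 12)
                                    (split (# 13)
                                      (byStrategies 13
                                        ( (3 , strategy (2 ∷ 4 ∷ 2 ∷ 0 ∷ 0 ∷ 1 ∷ 4 ∷ 0 ∷ 0 ∷ 0 ∷ 8 ∷ 2 ∷ 0 ∷ 0 ∷ 4 ∷ [])
                                                        (1 ∷ 10 ∷ 1 ∷ 9 ∷ 9 ∷ 0 ∷ 10 ∷ 9 ∷ 9 ∷ 9 ∷ 9 ∷ 1 ∷ 9 ∷ 9 ∷ 10 ∷ []))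
                                        ∷ (1 , strategy (8 ∷ 0 ∷ 8 ∷ 4 ∷ 0 ∷ 16 ∷ 2 ∷ 0 ∷ 32 ∷ 0 ∷ 0 ∷ 0 ∷ 0 ∷ 0 ∷ 1 ∷ [])
                                                        (5 ∷ 9 ∷ 5 ∷ 2 ∷ 9 ∷ 8 ∷ 3 ∷ 9 ∷ 9 ∷ 9 ∷ 9 ∷ 9 ∷ 9 ∷ 9 ∷ 6 ∷ []))
                                        ∷ []))
                                      (split (# 13)
                                        (split (# 14)
                                          (byStrategies 8
                                            ( (1 , strategy (8 ∷ 4 ∷ 8 ∷ 16 ∷ 4 ∷ 4 ∷ 4 ∷ 0 ∷ 32 ∷ 0 ∷ 0 ∷ 1 ∷ 2 ∷ 8 ∷ 0 ∷ [])
                                                            (3 ∷ 13 ∷ 3 ∷ 8 ∷ 0 ∷ 13 ∷ 2 ∷ 9 ∷ 9 ∷ 9 ∷ 9 ∷ 12 ∷ 5 ∷ 3 ∷ 9 ∷ []))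
                                            ∷ []))
                                          (split (# 14)
                                            (split (# 0)
                                              (byStrategies 4
                                                ( (1 , strategy (0 ∷ 2 ∷ 4 ∷ 4 ∷ 0 ∷ 0 ∷ 8 ∷ 0 ∷ 0 ∷ 0 ∷ 16 ∷ 1 ∷ 0 ∷ 0 ∷ 8 ∷ [])
                                                                (9 ∷ 3 ∷ 6 ∷ 6 ∷ 9 ∷ 9 ∷ 10 ∷ 9 ∷ 9 ∷ 9 ∷ 9 ∷ 1 ∷ 9 ∷ 9 ∷ 10 ∷ []))
                                                ∷ []))
                                              (split (# 0)
                                                (split (# 2)
                                                  infeasible
                                                  (split (# 2)
                                                    infeasible
                                                    (split (# 2)
                                                      infeasible
                                                      (split (# 2)
                                                        infeasible
                                                        (byMoves ((# 2 , # 1) ∷ (# 1 , # 0) ∷ (# 0 , # 3) ∷ (# 2 , # 5) ∷ (# 3 , # 4) ∷ (# 4 , # 7) ∷ (# 5 , # 12) ∷ (# 12 , # 7) ∷ (# 7 , # 9) ∷ []))))))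
                                                (split (# 0)
                                                  (split (# 2)
                                                    infeasible
                                                    (split (# 2)
                                                      infeasible
                                                      (byMoves ((# 0 , # 1) ∷ (# 1 , # 3) ∷ (# 2 , # 5) ∷ (# 3 , # 4) ∷ (# 4 , # 7) ∷ (# 5 , # 12) ∷ (# 12 , # 7) ∷ (# 7 , # 9) ∷ []))))
                                                  (split (# 0)
                                                    (split (# 2)
                                                      infeasible
                                                      (split (# 2)
                                                        infeasible
                                                        (byMoves ((# 0 , # 1) ∷ (# 1 , # 0) ∷ (# 0 , # 3) ∷ (# 2 , # 5) ∷ (# 3 , # 4) ∷ (# 4 , # 7) ∷ (# 5 , # 12) ∷ (# 12 , # 7) ∷ (# 7 , # 9) ∷ []))))
                                                    (byMoves ((# 0 , # 1) ∷ (# 0 , # 3) ∷ (# 1 , # 7) ∷ (# 3 , # 4) ∷ (# 4 , # 5) ∷ (# 5 , # 12) ∷ (# 12 , # 7) ∷ (# 7 , # 9) ∷ []))))))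
                                            (byStrategies 4
                                              ( (1 , strategy (4 ∷ 0 ∷ 4 ∷ 0 ∷ 8 ∷ 2 ∷ 8 ∷ 0 ∷ 0 ∷ 0 ∷ 16 ∷ 0 ∷ 0 ∷ 1 ∷ 8 ∷ [])
                                                              (4 ∷ 9 ∷ 6 ∷ 9 ∷ 10 ∷ 2 ∷ 10 ∷ 9 ∷ 9 ∷ 9 ∷ 9 ∷ 9 ∷ 9 ∷ 5 ∷ 10 ∷ []))
                                              ∷ []))))
                                        (byStrategies 8
                                          ( (1 , strategy (4 ∷ 8 ∷ 4 ∷ 2 ∷ 8 ∷ 4 ∷ 2 ∷ 16 ∷ 0 ∷ 0 ∷ 0 ∷ 4 ∷ 8 ∷ 8 ∷ 1 ∷ [])
                                                          (1 ∷ 7 ∷ 1 ∷ 0 ∷ 7 ∷ 12 ∷ 2 ∷ 9 ∷ 9 ∷ 9 ∷ 9 ∷ 12 ∷ 7 ∷ 7 ∷ 6 ∷ []))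
                                          ∷ (1 , strategy (4 ∷ 8 ∷ 4 ∷ 1 ∷ 2 ∷ 2 ∷ 2 ∷ 16 ∷ 0 ∷ 0 ∷ 0 ∷ 2 ∷ 8 ∷ 8 ∷ 8 ∷ [])
                                                          (12 ∷ 7 ∷ 1 ∷ 6 ∷ 0 ∷ 2 ∷ 2 ∷ 9 ∷ 9 ∷ 9 ∷ 9 ∷ 0 ∷ 7 ∷ 7 ∷ 7 ∷ []))
                                          ∷ []))))
                                    (byStrategies 7
                                      ( (3 , strategy (1 ∷ 2 ∷ 1 ∷ 0 ∷ 0 ∷ 0 ∷ 0 ∷ 4 ∷ 0 ∷ 0 ∷ 0 ∷ 0 ∷ 2 ∷ 0 ∷ 0 ∷ [])
                                                      (12 ∷ 7 ∷ 1 ∷ 9 ∷ 9 ∷ 9 ∷ 9 ∷ 9 ∷ 9 ∷ 9 ∷ 9 ∷ 9 ∷ 7 ∷ 9 ∷ 9 ∷ []))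
                                      ∷ (1 , strategy (4 ∷ 8 ∷ 4 ∷ 1 ∷ 2 ∷ 2 ∷ 2 ∷ 16 ∷ 0 ∷ 0 ∷ 0 ∷ 2 ∷ 8 ∷ 8 ∷ 8 ∷ [])
                                                      (12 ∷ 7 ∷ 1 ∷ 6 ∷ 0 ∷ 2 ∷ 2 ∷ 9 ∷ 9 ∷ 9 ∷ 9 ∷ 0 ∷ 7 ∷ 7 ∷ 7 ∷ []))
                                      ∷ []))))
                                (byStrategies 2
                                  ( (1 , strategy (1 ∷ 2 ∷ 1 ∷ 0 ∷ 0 ∷ 0 ∷ 2 ∷ 0 ∷ 0 ∷ 0 ∷ 4 ∷ 2 ∷ 1 ∷ 1 ∷ 0 ∷ [])
                                                  (1 ∷ 10 ∷ 1 ∷ 9 ∷ 9 ∷ 9 ∷ 10 ∷ 9 ∷ 9 ∷ 9 ∷ 9 ∷ 10 ∷ 11 ∷ 1 ∷ 9 ∷ []))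
                                  ∷ (1 , strategy (1 ∷ 2 ∷ 1 ∷ 0 ∷ 2 ∷ 0 ∷ 2 ∷ 0 ∷ 0 ∷ 0 ∷ 4 ∷ 2 ∷ 1 ∷ 1 ∷ 2 ∷ [])
                                                  (11 ∷ 10 ∷ 1 ∷ 9 ∷ 10 ∷ 9 ∷ 10 ∷ 9 ∷ 9 ∷ 9 ∷ 9 ∷ 10 ∷ 11 ∷ 1 ∷ 10 ∷ []))
                                  ∷ []))))
                            (byStrategies 6
                              ( (1 , strategy (1 ∷ 2 ∷ 1 ∷ 0 ∷ 2 ∷ 1 ∷ 1 ∷ 4 ∷ 0 ∷ 0 ∷ 0 ∷ 0 ∷ 2 ∷ 2 ∷ 2 ∷ [])
                                              (1 ∷ 7 ∷ 1 ∷ 9 ∷ 7 ∷ 12 ∷ 14 ∷ 9 ∷ 9 ∷ 9 ∷ 9 ∷ 9 ∷ 7 ∷ 7 ∷ 7 ∷ []))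
                              ∷ (1 , strategy (1 ∷ 2 ∷ 1 ∷ 0 ∷ 0 ∷ 0 ∷ 2 ∷ 0 ∷ 0 ∷ 0 ∷ 4 ∷ 2 ∷ 1 ∷ 1 ∷ 0 ∷ [])
                                              (1 ∷ 10 ∷ 1 ∷ 9 ∷ 9 ∷ 9 ∷ 10 ∷ 9 ∷ 9 ∷ 9 ∷ 9 ∷ 10 ∷ 11 ∷ 1 ∷ 9 ∷ []))
                              ∷ (2 , strategy (1 ∷ 2 ∷ 1 ∷ 0 ∷ 2 ∷ 0 ∷ 2 ∷ 0 ∷ 0 ∷ 0 ∷ 4 ∷ 2 ∷ 1 ∷ 1 ∷ 2 ∷ [])
                                              (11 ∷ 10 ∷ 1 ∷ 9 ∷ 10 ∷ 9 ∷ 10 ∷ 9 ∷ 9 ∷ 9 ∷ 9 ∷ 10 ∷ 11 ∷ 1 ∷ 10 ∷ []))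
                              ∷ (1 , strategy (2 ∷ 4 ∷ 2 ∷ 2 ∷ 0 ∷ 0 ∷ 4 ∷ 0 ∷ 0 ∷ 0 ∷ 8 ∷ 0 ∷ 1 ∷ 1 ∷ 0 ∷ [])
                                              (1 ∷ 10 ∷ 6 ∷ 6 ∷ 9 ∷ 9 ∷ 10 ∷ 9 ∷ 9 ∷ 9 ∷ 9 ∷ 9 ∷ 0 ∷ 3 ∷ 9 ∷ []))
                              ∷ []))))
                        (byStrategies 11
                          ( (2 , strategy (1 ∷ 2 ∷ 1 ∷ 1 ∷ 2 ∷ 1 ∷ 1 ∷ 4 ∷ 0 ∷ 0 ∷ 0 ∷ 1 ∷ 2 ∷ 2 ∷ 2 ∷ [])
                                          (12 ∷ 7 ∷ 1 ∷ 13 ∷ 7 ∷ 13 ∷ 14 ∷ 9 ∷ 9 ∷ 9 ∷ 9 ∷ 12 ∷ 7 ∷ 7 ∷ 7 ∷ []))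
                          ∷ (1 , strategy (2 ∷ 0 ∷ 2 ∷ 4 ∷ 2 ∷ 4 ∷ 0 ∷ 0 ∷ 8 ∷ 0 ∷ 0 ∷ 1 ∷ 2 ∷ 2 ∷ 0 ∷ [])
                                          (3 ∷ 9 ∷ 3 ∷ 8 ∷ 5 ∷ 8 ∷ 9 ∷ 9 ∷ 9 ∷ 9 ∷ 9 ∷ 0 ∷ 5 ∷ 5 ∷ 9 ∷ []))
                          ∷ (1 , strategy (2 ∷ 0 ∷ 2 ∷ 0 ∷ 0 ∷ 4 ∷ 1 ∷ 0 ∷ 8 ∷ 0 ∷ 0 ∷ 1 ∷ 2 ∷ 2 ∷ 0 ∷ [])
                                          (5 ∷ 9 ∷ 5 ∷ 9 ∷ 9 ∷ 8 ∷ 2 ∷ 9 ∷ 9 ∷ 9 ∷ 9 ∷ 0 ∷ 5 ∷ 5 ∷ 9 ∷ []))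
                          ∷ (1 , strategy (2 ∷ 2 ∷ 2 ∷ 4 ∷ 2 ∷ 4 ∷ 2 ∷ 0 ∷ 8 ∷ 0 ∷ 0 ∷ 1 ∷ 0 ∷ 0 ∷ 1 ∷ [])
                                          (3 ∷ 3 ∷ 3 ∷ 8 ∷ 3 ∷ 8 ∷ 3 ∷ 9 ∷ 9 ∷ 9 ∷ 9 ∷ 0 ∷ 9 ∷ 9 ∷ 4 ∷ []))
                          ∷ (3 , strategy (1 ∷ 2 ∷ 1 ∷ 0 ∷ 2 ∷ 1 ∷ 2 ∷ 0 ∷ 0 ∷ 0 ∷ 4 ∷ 2 ∷ 1 ∷ 1 ∷ 2 ∷ [])
                                          (11 ∷ 10 ∷ 1 ∷ 9 ∷ 10 ∷ 4 ∷ 10 ∷ 9 ∷ 9 ∷ 9 ∷ 9 ∷ 10 ∷ 11 ∷ 1 ∷ 10 ∷ []))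
                          ∷ []))))
                    (byStrategies 26
                      ( (6 , strategy (1 ∷ 2 ∷ 1 ∷ 1 ∷ 2 ∷ 1 ∷ 0 ∷ 0 ∷ 0 ∷ 0 ∷ 4 ∷ 2 ∷ 1 ∷ 0 ∷ 2 ∷ [])
                                      (11 ∷ 10 ∷ 1 ∷ 1 ∷ 10 ∷ 4 ∷ 9 ∷ 9 ∷ 9 ∷ 9 ∷ 9 ∷ 10 ∷ 11 ∷ 9 ∷ 10 ∷ []))
                      ∷ (4 , strategy (1 ∷ 2 ∷ 1 ∷ 0 ∷ 2 ∷ 1 ∷ 2 ∷ 0 ∷ 0 ∷ 0 ∷ 4 ∷ 0 ∷ 0 ∷ 1 ∷ 2 ∷ [])
                                      (1 ∷ 10 ∷ 1 ∷ 9 ∷ 10 ∷ 4 ∷ 10 ∷ 9 ∷ 9 ∷ 9 ∷ 9 ∷ 9 ∷ 9 ∷ 1 ∷ 10 ∷ []))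
                      ∷ (2 , strategy (1 ∷ 2 ∷ 1 ∷ 1 ∷ 2 ∷ 1 ∷ 2 ∷ 0 ∷ 0 ∷ 0 ∷ 4 ∷ 2 ∷ 0 ∷ 1 ∷ 2 ∷ [])
                                      (4 ∷ 10 ∷ 1 ∷ 4 ∷ 10 ∷ 4 ∷ 10 ∷ 9 ∷ 9 ∷ 9 ∷ 9 ∷ 10 ∷ 9 ∷ 1 ∷ 10 ∷ []))
                      ∷ (3 , strategy (4 ∷ 8 ∷ 4 ∷ 2 ∷ 8 ∷ 4 ∷ 2 ∷ 16 ∷ 0 ∷ 0 ∷ 0 ∷ 4 ∷ 8 ∷ 8 ∷ 1 ∷ [])
                                      (1 ∷ 7 ∷ 1 ∷ 0 ∷ 7 ∷ 12 ∷ 2 ∷ 9 ∷ 9 ∷ 9 ∷ 9 ∷ 12 ∷ 7 ∷ 7 ∷ 6 ∷ []))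
                      ∷ (4 , strategy (1 ∷ 2 ∷ 1 ∷ 0 ∷ 2 ∷ 1 ∷ 2 ∷ 0 ∷ 0 ∷ 0 ∷ 4 ∷ 0 ∷ 0 ∷ 0 ∷ 0 ∷ [])
                                      (1 ∷ 10 ∷ 1 ∷ 9 ∷ 10 ∷ 4 ∷ 10 ∷ 9 ∷ 9 ∷ 9 ∷ 9 ∷ 9 ∷ 9 ∷ 9 ∷ 9 ∷ []))
                      ∷ []))))
                (byStrategies 190
                  ( (20 , strategy (1 ∷ 2 ∷ 1 ∷ 1 ∷ 2 ∷ 1 ∷ 1 ∷ 4 ∷ 0 ∷ 0 ∷ 0 ∷ 1 ∷ 2 ∷ 2 ∷ 2 ∷ [])
                                   (12 ∷ 7 ∷ 1 ∷ 13 ∷ 7 ∷ 13 ∷ 14 ∷ 9 ∷ 9 ∷ 9 ∷ 9 ∷ 12 ∷ 7 ∷ 7 ∷ 7 ∷ []))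
                  ∷ (6 , strategy (1 ∷ 0 ∷ 1 ∷ 2 ∷ 0 ∷ 2 ∷ 1 ∷ 0 ∷ 4 ∷ 0 ∷ 0 ∷ 0 ∷ 1 ∷ 1 ∷ 0 ∷ [])
                                  (5 ∷ 9 ∷ 5 ∷ 8 ∷ 9 ∷ 8 ∷ 3 ∷ 9 ∷ 9 ∷ 9 ∷ 9 ∷ 9 ∷ 5 ∷ 5 ∷ 9 ∷ []))
                  ∷ (30 , strategy (1 ∷ 2 ∷ 1 ∷ 1 ∷ 0 ∷ 0 ∷ 2 ∷ 0 ∷ 0 ∷ 0 ∷ 4 ∷ 2 ∷ 1 ∷ 1 ∷ 2 ∷ [])
                                   (11 ∷ 10 ∷ 1 ∷ 1 ∷ 9 ∷ 9 ∷ 10 ∷ 9 ∷ 9 ∷ 9 ∷ 9 ∷ 10 ∷ 11 ∷ 1 ∷ 10 ∷ []))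
                  ∷ (30 , strategy (1 ∷ 2 ∷ 1 ∷ 1 ∷ 2 ∷ 0 ∷ 2 ∷ 0 ∷ 0 ∷ 0 ∷ 4 ∷ 2 ∷ 1 ∷ 1 ∷ 2 ∷ [])
                                   (1 ∷ 10 ∷ 6 ∷ 6 ∷ 10 ∷ 9 ∷ 10 ∷ 9 ∷ 9 ∷ 9 ∷ 9 ∷ 10 ∷ 11 ∷ 1 ∷ 10 ∷ []))
                  ∷ (6 , strategy (1 ∷ 2 ∷ 1 ∷ 1 ∷ 2 ∷ 0 ∷ 1 ∷ 4 ∷ 0 ∷ 0 ∷ 0 ∷ 1 ∷ 2 ∷ 2 ∷ 2 ∷ [])
                                  (1 ∷ 7 ∷ 1 ∷ 1 ∷ 7 ∷ 9 ∷ 14 ∷ 9 ∷ 9 ∷ 9 ∷ 9 ∷ 1 ∷ 7 ∷ 7 ∷ 7 ∷ []))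
                  ∷ (30 , strategy (2 ∷ 0 ∷ 2 ∷ 4 ∷ 2 ∷ 4 ∷ 0 ∷ 0 ∷ 8 ∷ 0 ∷ 0 ∷ 1 ∷ 2 ∷ 2 ∷ 0 ∷ [])
                                   (3 ∷ 9 ∷ 3 ∷ 8 ∷ 5 ∷ 8 ∷ 9 ∷ 9 ∷ 9 ∷ 9 ∷ 9 ∷ 0 ∷ 5 ∷ 5 ∷ 9 ∷ []))
                  ∷ (5 , strategy (4 ∷ 2 ∷ 4 ∷ 8 ∷ 4 ∷ 8 ∷ 4 ∷ 0 ∷ 16 ∷ 0 ∷ 0 ∷ 1 ∷ 4 ∷ 0 ∷ 2 ∷ [])
                                  (5 ∷ 2 ∷ 3 ∷ 8 ∷ 5 ∷ 8 ∷ 3 ∷ 9 ∷ 9 ∷ 9 ∷ 9 ∷ 1 ∷ 5 ∷ 9 ∷ 4 ∷ []))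
                  ∷ (6 , strategy (4 ∷ 4 ∷ 4 ∷ 8 ∷ 1 ∷ 2 ∷ 4 ∷ 0 ∷ 16 ∷ 0 ∷ 0 ∷ 2 ∷ 0 ∷ 2 ∷ 2 ∷ [])
                                  (3 ∷ 3 ∷ 3 ∷ 8 ∷ 14 ∷ 2 ∷ 3 ∷ 9 ∷ 9 ∷ 9 ∷ 9 ∷ 0 ∷ 9 ∷ 1 ∷ 6 ∷ []))
                  ∷ []))))
            (byStrategies 4
              ( (2 , strategy (1 ∷ 2 ∷ 1 ∷ 1 ∷ 2 ∷ 1 ∷ 2 ∷ 0 ∷ 0 ∷ 0 ∷ 4 ∷ 2 ∷ 0 ∷ 1 ∷ 2 ∷ [])
                              (4 ∷ 10 ∷ 1 ∷ 4 ∷ 10 ∷ 4 ∷ 10 ∷ 9 ∷ 9 ∷ 9 ∷ 9 ∷ 10 ∷ 9 ∷ 1 ∷ 10 ∷ []))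
              ∷ (1 , strategy (1 ∷ 2 ∷ 1 ∷ 1 ∷ 0 ∷ 1 ∷ 0 ∷ 4 ∷ 0 ∷ 0 ∷ 0 ∷ 0 ∷ 2 ∷ 2 ∷ 0 ∷ [])
                              (12 ∷ 7 ∷ 1 ∷ 13 ∷ 9 ∷ 12 ∷ 9 ∷ 9 ∷ 9 ∷ 9 ∷ 9 ∷ 9 ∷ 7 ∷ 7 ∷ 9 ∷ []))
              ∷ (1 , strategy (1 ∷ 2 ∷ 1 ∷ 1 ∷ 0 ∷ 1 ∷ 0 ∷ 4 ∷ 0 ∷ 0 ∷ 0 ∷ 0 ∷ 2 ∷ 0 ∷ 0 ∷ [])
                              (12 ∷ 7 ∷ 1 ∷ 1 ∷ 9 ∷ 12 ∷ 9 ∷ 9 ∷ 9 ∷ 9 ∷ 9 ∷ 9 ∷ 7 ∷ 9 ∷ 9 ∷ []))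
              ∷ []))))
        (byStrategies 8
          ( (1 , strategy (0 ∷ 0 ∷ 2 ∷ 0 ∷ 0 ∷ 4 ∷ 1 ∷ 16 ∷ 0 ∷ 0 ∷ 0 ∷ 0 ∷ 8 ∷ 0 ∷ 0 ∷ [])
                          (9 ∷ 9 ∷ 5 ∷ 9 ∷ 9 ∷ 12 ∷ 2 ∷ 9 ∷ 9 ∷ 9 ∷ 9 ∷ 9 ∷ 7 ∷ 9 ∷ 9 ∷ []))
          ∷ (1 , strategy (1 ∷ 0 ∷ 1 ∷ 2 ∷ 0 ∷ 0 ∷ 1 ∷ 8 ∷ 0 ∷ 0 ∷ 0 ∷ 0 ∷ 0 ∷ 4 ∷ 0 ∷ [])
                          (3 ∷ 9 ∷ 3 ∷ 13 ∷ 9 ∷ 9 ∷ 3 ∷ 9 ∷ 9 ∷ 9 ∷ 9 ∷ 9 ∷ 9 ∷ 7 ∷ 9 ∷ []))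
          ∷ (2 , strategy (0 ∷ 0 ∷ 1 ∷ 0 ∷ 0 ∷ 0 ∷ 2 ∷ 8 ∷ 0 ∷ 0 ∷ 0 ∷ 0 ∷ 0 ∷ 0 ∷ 4 ∷ [])
                          (9 ∷ 9 ∷ 6 ∷ 9 ∷ 9 ∷ 9 ∷ 14 ∷ 9 ∷ 9 ∷ 9 ∷ 9 ∷ 9 ∷ 9 ∷ 9 ∷ 7 ∷ []))
          ∷ (1 , strategy (1 ∷ 0 ∷ 0 ∷ 0 ∷ 0 ∷ 0 ∷ 2 ∷ 8 ∷ 0 ∷ 0 ∷ 0 ∷ 2 ∷ 4 ∷ 4 ∷ 4 ∷ [])
                          (11 ∷ 9 ∷ 9 ∷ 9 ∷ 9 ∷ 9 ∷ 14 ∷ 9 ∷ 9 ∷ 9 ∷ 9 ∷ 12 ∷ 7 ∷ 7 ∷ 7 ∷ []))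
          ∷ (2 , strategy (2 ∷ 0 ∷ 0 ∷ 0 ∷ 4 ∷ 2 ∷ 0 ∷ 8 ∷ 0 ∷ 0 ∷ 0 ∷ 1 ∷ 0 ∷ 0 ∷ 0 ∷ [])
                          (4 ∷ 9 ∷ 9 ∷ 9 ∷ 7 ∷ 4 ∷ 9 ∷ 9 ∷ 9 ∷ 9 ∷ 9 ∷ 0 ∷ 9 ∷ 9 ∷ 9 ∷ []))
          ∷ (1 , strategy (2 ∷ 8 ∷ 4 ∷ 4 ∷ 0 ∷ 1 ∷ 2 ∷ 16 ∷ 0 ∷ 0 ∷ 0 ∷ 4 ∷ 0 ∷ 0 ∷ 0 ∷ [])
                          (11 ∷ 7 ∷ 1 ∷ 1 ∷ 9 ∷ 0 ∷ 3 ∷ 9 ∷ 9 ∷ 9 ∷ 9 ∷ 1 ∷ 9 ∷ 9 ∷ 9 ∷ []))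
          ∷ (1 , strategy (0 ∷ 0 ∷ 0 ∷ 2 ∷ 0 ∷ 0 ∷ 1 ∷ 8 ∷ 0 ∷ 0 ∷ 0 ∷ 0 ∷ 0 ∷ 4 ∷ 0 ∷ [])
                          (9 ∷ 9 ∷ 9 ∷ 13 ∷ 9 ∷ 9 ∷ 3 ∷ 9 ∷ 9 ∷ 9 ∷ 9 ∷ 9 ∷ 9 ∷ 7 ∷ 9 ∷ []))
          ∷ [])))
      (byStrategies 5810
        ( (840 , strategy (0 ∷ 0 ∷ 2 ∷ 2 ∷ 0 ∷ 0 ∷ 4 ∷ 0 ∷ 0 ∷ 0 ∷ 8 ∷ 4 ∷ 2 ∷ 1 ∷ 0 ∷ [])
                          (9 ∷ 9 ∷ 6 ∷ 6 ∷ 9 ∷ 9 ∷ 10 ∷ 9 ∷ 9 ∷ 9 ∷ 9 ∷ 10 ∷ 11 ∷ 3 ∷ 9 ∷ []))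
        ∷ (945 , strategy (1 ∷ 2 ∷ 1 ∷ 1 ∷ 2 ∷ 1 ∷ 0 ∷ 0 ∷ 0 ∷ 0 ∷ 4 ∷ 0 ∷ 0 ∷ 0 ∷ 0 ∷ [])
                          (1 ∷ 10 ∷ 1 ∷ 1 ∷ 10 ∷ 4 ∷ 9 ∷ 9 ∷ 9 ∷ 9 ∷ 9 ∷ 9 ∷ 9 ∷ 9 ∷ 9 ∷ []))
        ∷ (126 , strategy (0 ∷ 0 ∷ 0 ∷ 1 ∷ 2 ∷ 1 ∷ 2 ∷ 0 ∷ 0 ∷ 0 ∷ 4 ∷ 2 ∷ 0 ∷ 0 ∷ 0 ∷ [])
                          (9 ∷ 9 ∷ 9 ∷ 4 ∷ 10 ∷ 4 ∷ 10 ∷ 9 ∷ 9 ∷ 9 ∷ 9 ∷ 10 ∷ 9 ∷ 9 ∷ 9 ∷ []))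
        ∷ (180 , strategy (0 ∷ 0 ∷ 1 ∷ 1 ∷ 2 ∷ 1 ∷ 2 ∷ 0 ∷ 0 ∷ 0 ∷ 4 ∷ 2 ∷ 0 ∷ 0 ∷ 0 ∷ [])
                          (9 ∷ 9 ∷ 6 ∷ 6 ∷ 10 ∷ 4 ∷ 10 ∷ 9 ∷ 9 ∷ 9 ∷ 9 ∷ 10 ∷ 9 ∷ 9 ∷ 9 ∷ []))
        ∷ (840 , strategy (1 ∷ 0 ∷ 0 ∷ 1 ∷ 2 ∷ 1 ∷ 0 ∷ 0 ∷ 0 ∷ 0 ∷ 4 ∷ 2 ∷ 1 ∷ 0 ∷ 2 ∷ [])
                          (11 ∷ 9 ∷ 9 ∷ 4 ∷ 10 ∷ 4 ∷ 9 ∷ 9 ∷ 9 ∷ 9 ∷ 9 ∷ 10 ∷ 11 ∷ 9 ∷ 10 ∷ []))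
        ∷ (1260 , strategy (1 ∷ 0 ∷ 0 ∷ 1 ∷ 0 ∷ 1 ∷ 0 ∷ 4 ∷ 0 ∷ 0 ∷ 0 ∷ 0 ∷ 2 ∷ 2 ∷ 2 ∷ [])
                           (12 ∷ 9 ∷ 9 ∷ 13 ∷ 9 ∷ 13 ∷ 9 ∷ 9 ∷ 9 ∷ 9 ∷ 9 ∷ 9 ∷ 7 ∷ 7 ∷ 7 ∷ []))
        ∷ (980 , strategy (2 ∷ 4 ∷ 2 ∷ 0 ∷ 0 ∷ 1 ∷ 0 ∷ 0 ∷ 0 ∷ 0 ∷ 8 ∷ 0 ∷ 0 ∷ 2 ∷ 0 ∷ [])
                          (1 ∷ 10 ∷ 1 ∷ 9 ∷ 9 ∷ 0 ∷ 9 ∷ 9 ∷ 9 ∷ 9 ∷ 9 ∷ 9 ∷ 9 ∷ 1 ∷ 9 ∷ []))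
        ∷ (105 , strategy (1 ∷ 0 ∷ 16 ∷ 0 ∷ 0 ∷ 8 ∷ 32 ∷ 0 ∷ 0 ∷ 0 ∷ 64 ∷ 2 ∷ 4 ∷ 0 ∷ 0 ∷ [])
                          (11 ∷ 9 ∷ 6 ∷ 9 ∷ 9 ∷ 2 ∷ 10 ∷ 9 ∷ 9 ∷ 9 ∷ 9 ∷ 12 ∷ 5 ∷ 9 ∷ 9 ∷ []))
        ∷ (560 , strategy (1 ∷ 0 ∷ 0 ∷ 1 ∷ 2 ∷ 1 ∷ 0 ∷ 0 ∷ 0 ∷ 0 ∷ 4 ∷ 0 ∷ 0 ∷ 0 ∷ 2 ∷ [])
                          (4 ∷ 9 ∷ 9 ∷ 4 ∷ 10 ∷ 4 ∷ 9 ∷ 9 ∷ 9 ∷ 9 ∷ 9 ∷ 9 ∷ 9 ∷ 9 ∷ 10 ∷ []))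
        ∷ (105 , strategy (4 ∷ 0 ∷ 1 ∷ 2 ∷ 16 ∷ 8 ∷ 0 ∷ 0 ∷ 0 ∷ 0 ∷ 32 ∷ 0 ∷ 4 ∷ 4 ∷ 16 ∷ [])
                          (5 ∷ 9 ∷ 3 ∷ 0 ∷ 10 ∷ 4 ∷ 9 ∷ 9 ∷ 9 ∷ 9 ∷ 9 ∷ 9 ∷ 5 ∷ 5 ∷ 10 ∷ []))
        ∷ (105 , strategy (1 ∷ 0 ∷ 0 ∷ 0 ∷ 0 ∷ 0 ∷ 0 ∷ 0 ∷ 0 ∷ 0 ∷ 4 ∷ 2 ∷ 1 ∷ 0 ∷ 0 ∷ [])
                          (11 ∷ 9 ∷ 9 ∷ 9 ∷ 9 ∷ 9 ∷ 9 ∷ 9 ∷ 9 ∷ 9 ∷ 9 ∷ 10 ∷ 11 ∷ 9 ∷ 9 ∷ []))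
        ∷ (105 , strategy (0 ∷ 0 ∷ 1 ∷ 2 ∷ 0 ∷ 2 ∷ 0 ∷ 8 ∷ 0 ∷ 0 ∷ 0 ∷ 0 ∷ 4 ∷ 4 ∷ 0 ∷ [])
                          (9 ∷ 9 ∷ 5 ∷ 13 ∷ 9 ∷ 13 ∷ 9 ∷ 9 ∷ 9 ∷ 9 ∷ 9 ∷ 9 ∷ 7 ∷ 7 ∷ 9 ∷ []))
        ∷ [])))
    (byStrategies 1122
      ( (144 , strategy (0 ∷ 2 ∷ 1 ∷ 0 ∷ 2 ∷ 0 ∷ 0 ∷ 4 ∷ 0 ∷ 0 ∷ 0 ∷ 1 ∷ 2 ∷ 2 ∷ 2 ∷ [])
                        (9 ∷ 7 ∷ 1 ∷ 9 ∷ 7 ∷ 9 ∷ 9 ∷ 9 ∷ 9 ∷ 9 ∷ 9 ∷ 12 ∷ 7 ∷ 7 ∷ 7 ∷ []))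
      ∷ (21 , strategy (1 ∷ 2 ∷ 1 ∷ 1 ∷ 2 ∷ 0 ∷ 1 ∷ 4 ∷ 0 ∷ 0 ∷ 0 ∷ 1 ∷ 2 ∷ 2 ∷ 2 ∷ [])
                       (1 ∷ 7 ∷ 1 ∷ 1 ∷ 7 ∷ 9 ∷ 14 ∷ 9 ∷ 9 ∷ 9 ∷ 9 ∷ 1 ∷ 7 ∷ 7 ∷ 7 ∷ []))
      ∷ (48 , strategy (0 ∷ 0 ∷ 1 ∷ 0 ∷ 2 ∷ 0 ∷ 2 ∷ 0 ∷ 0 ∷ 0 ∷ 4 ∷ 2 ∷ 1 ∷ 0 ∷ 2 ∷ [])
                       (9 ∷ 9 ∷ 6 ∷ 9 ∷ 10 ∷ 9 ∷ 10 ∷ 9 ∷ 9 ∷ 9 ∷ 9 ∷ 10 ∷ 11 ∷ 9 ∷ 10 ∷ []))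
      ∷ (21 , strategy (0 ∷ 0 ∷ 1 ∷ 2 ∷ 4 ∷ 0 ∷ 0 ∷ 8 ∷ 0 ∷ 0 ∷ 0 ∷ 0 ∷ 4 ∷ 4 ∷ 2 ∷ [])
                       (9 ∷ 9 ∷ 3 ∷ 4 ∷ 7 ∷ 9 ∷ 9 ∷ 9 ∷ 9 ∷ 9 ∷ 9 ∷ 9 ∷ 7 ∷ 7 ∷ 4 ∷ []))
      ∷ (28 , strategy (1 ∷ 2 ∷ 0 ∷ 1 ∷ 2 ∷ 1 ∷ 2 ∷ 0 ∷ 0 ∷ 0 ∷ 4 ∷ 2 ∷ 0 ∷ 0 ∷ 0 ∷ [])
                       (4 ∷ 10 ∷ 9 ∷ 6 ∷ 10 ∷ 4 ∷ 10 ∷ 9 ∷ 9 ∷ 9 ∷ 9 ∷ 10 ∷ 9 ∷ 9 ∷ 9 ∷ []))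
      ∷ (21 , strategy (8 ∷ 4 ∷ 2 ∷ 2 ∷ 16 ∷ 4 ∷ 8 ∷ 2 ∷ 1 ∷ 0 ∷ 32 ∷ 16 ∷ 8 ∷ 1 ∷ 16 ∷ [])
                       (4 ∷ 0 ∷ 5 ∷ 1 ∷ 10 ∷ 0 ∷ 14 ∷ 1 ∷ 3 ∷ 9 ∷ 9 ∷ 10 ∷ 11 ∷ 7 ∷ 10 ∷ []))
      ∷ (63 , strategy (1 ∷ 2 ∷ 1 ∷ 0 ∷ 0 ∷ 0 ∷ 1 ∷ 4 ∷ 0 ∷ 0 ∷ 0 ∷ 1 ∷ 2 ∷ 2 ∷ 2 ∷ [])
                       (1 ∷ 7 ∷ 1 ∷ 9 ∷ 9 ∷ 9 ∷ 14 ∷ 9 ∷ 9 ∷ 9 ∷ 9 ∷ 1 ∷ 7 ∷ 7 ∷ 7 ∷ []))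
      ∷ (21 , strategy (4 ∷ 2 ∷ 4 ∷ 8 ∷ 4 ∷ 8 ∷ 4 ∷ 0 ∷ 16 ∷ 0 ∷ 0 ∷ 1 ∷ 4 ∷ 0 ∷ 2 ∷ [])
                       (5 ∷ 2 ∷ 3 ∷ 8 ∷ 5 ∷ 8 ∷ 3 ∷ 9 ∷ 9 ∷ 9 ∷ 9 ∷ 1 ∷ 5 ∷ 9 ∷ 4 ∷ []))
      ∷ (168 , strategy (2 ∷ 0 ∷ 2 ∷ 0 ∷ 0 ∷ 4 ∷ 1 ∷ 0 ∷ 8 ∷ 0 ∷ 0 ∷ 1 ∷ 2 ∷ 2 ∷ 0 ∷ [])
                        (5 ∷ 9 ∷ 5 ∷ 9 ∷ 9 ∷ 8 ∷ 2 ∷ 9 ∷ 9 ∷ 9 ∷ 9 ∷ 0 ∷ 5 ∷ 5 ∷ 9 ∷ []))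
      ∷ (105 , strategy (4 ∷ 4 ∷ 4 ∷ 8 ∷ 1 ∷ 2 ∷ 4 ∷ 0 ∷ 16 ∷ 0 ∷ 0 ∷ 2 ∷ 0 ∷ 2 ∷ 2 ∷ [])
                        (3 ∷ 3 ∷ 3 ∷ 8 ∷ 14 ∷ 2 ∷ 3 ∷ 9 ∷ 9 ∷ 9 ∷ 9 ∷ 0 ∷ 9 ∷ 1 ∷ 6 ∷ []))
      ∷ (21 , strategy (2 ∷ 0 ∷ 0 ∷ 4 ∷ 0 ∷ 0 ∷ 2 ∷ 0 ∷ 8 ∷ 0 ∷ 0 ∷ 1 ∷ 1 ∷ 2 ∷ 0 ∷ [])
                       (3 ∷ 9 ∷ 9 ∷ 8 ∷ 9 ∷ 9 ∷ 3 ∷ 9 ∷ 9 ∷ 9 ∷ 9 ∷ 0 ∷ 0 ∷ 3 ∷ 9 ∷ []))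
      ∷ (56 , strategy (1 ∷ 2 ∷ 0 ∷ 1 ∷ 2 ∷ 1 ∷ 2 ∷ 0 ∷ 0 ∷ 0 ∷ 4 ∷ 1 ∷ 0 ∷ 0 ∷ 0 ∷ [])
                       (1 ∷ 10 ∷ 9 ∷ 6 ∷ 10 ∷ 4 ∷ 10 ∷ 9 ∷ 9 ∷ 9 ∷ 9 ∷ 1 ∷ 9 ∷ 9 ∷ 9 ∷ []))
      ∷ []))

certificate₁₀ : Certificate 15
certificate₁₀ =
  byStrategies 45589165
    ( (255024 , strategy (4 ∷ 16 ∷ 8 ∷ 8 ∷ 2 ∷ 4 ∷ 4 ∷ 4 ∷ 1 ∷ 2 ∷ 0 ∷ 2 ∷ 2 ∷ 8 ∷ 1 ∷ [])
                         (3 ∷ 10 ∷ 1 ∷ 1 ∷ 0 ∷ 2 ∷ 3 ∷ 13 ∷ 9 ∷ 7 ∷ 10 ∷ 0 ∷ 0 ∷ 1 ∷ 4 ∷ []))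
    ∷ (566720 , strategy (2 ∷ 2 ∷ 8 ∷ 4 ∷ 32 ∷ 16 ∷ 4 ∷ 4 ∷ 2 ∷ 2 ∷ 0 ∷ 1 ∷ 8 ∷ 8 ∷ 16 ∷ [])
                         (3 ∷ 7 ∷ 5 ∷ 2 ∷ 10 ∷ 4 ∷ 2 ∷ 13 ∷ 3 ∷ 7 ∷ 10 ∷ 0 ∷ 5 ∷ 5 ∷ 4 ∷ []))
    ∷ (91080 , strategy (4 ∷ 2 ∷ 1 ∷ 16 ∷ 4 ∷ 8 ∷ 32 ∷ 32 ∷ 4 ∷ 16 ∷ 0 ∷ 1 ∷ 16 ∷ 16 ∷ 64 ∷ [])
                        (5 ∷ 0 ∷ 1 ∷ 6 ∷ 5 ∷ 13 ∷ 14 ∷ 14 ∷ 5 ∷ 7 ∷ 10 ∷ 1 ∷ 7 ∷ 7 ∷ 10 ∷ []))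
    ∷ (956340 , strategy (4 ∷ 2 ∷ 4 ∷ 8 ∷ 4 ∷ 8 ∷ 4 ∷ 16 ∷ 16 ∷ 32 ∷ 0 ∷ 1 ∷ 8 ∷ 8 ∷ 2 ∷ [])
                         (5 ∷ 0 ∷ 3 ∷ 8 ∷ 5 ∷ 8 ∷ 3 ∷ 9 ∷ 9 ∷ 10 ∷ 10 ∷ 1 ∷ 7 ∷ 7 ∷ 4 ∷ []))
    ∷ (231840 , strategy (2 ∷ 16 ∷ 8 ∷ 8 ∷ 4 ∷ 2 ∷ 2 ∷ 8 ∷ 1 ∷ 4 ∷ 0 ∷ 2 ∷ 4 ∷ 8 ∷ 4 ∷ [])
                         (12 ∷ 10 ∷ 1 ∷ 1 ∷ 3 ∷ 12 ∷ 14 ∷ 1 ∷ 5 ∷ 7 ∷ 10 ∷ 12 ∷ 7 ∷ 1 ∷ 7 ∷ []))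
    ∷ (1147608 , strategy (4 ∷ 2 ∷ 8 ∷ 8 ∷ 1 ∷ 2 ∷ 16 ∷ 4 ∷ 4 ∷ 2 ∷ 0 ∷ 2 ∷ 1 ∷ 4 ∷ 8 ∷ [])
                          (3 ∷ 0 ∷ 6 ∷ 6 ∷ 5 ∷ 8 ∷ 10 ∷ 14 ∷ 3 ∷ 8 ∷ 10 ∷ 0 ∷ 11 ∷ 3 ∷ 6 ∷ []))
    ∷ (79695 , strategy (4 ∷ 2 ∷ 32 ∷ 4 ∷ 8 ∷ 16 ∷ 64 ∷ 4 ∷ 8 ∷ 2 ∷ 0 ∷ 1 ∷ 8 ∷ 8 ∷ 128 ∷ [])
                        (4 ∷ 3 ∷ 6 ∷ 13 ∷ 5 ∷ 2 ∷ 14 ∷ 4 ∷ 5 ∷ 7 ∷ 10 ∷ 1 ∷ 5 ∷ 5 ∷ 10 ∷ []))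
    ∷ (115920 , strategy (128 ∷ 4 ∷ 8 ∷ 32 ∷ 64 ∷ 64 ∷ 16 ∷ 2 ∷ 32 ∷ 1 ∷ 0 ∷ 256 ∷ 128 ∷ 32 ∷ 8 ∷ [])
                         (11 ∷ 2 ∷ 6 ∷ 4 ∷ 0 ∷ 0 ∷ 3 ∷ 1 ∷ 5 ∷ 7 ∷ 10 ∷ 10 ∷ 11 ∷ 5 ∷ 6 ∷ []))
    ∷ (478170 , strategy (2 ∷ 1 ∷ 8 ∷ 16 ∷ 8 ∷ 16 ∷ 8 ∷ 4 ∷ 32 ∷ 2 ∷ 0 ∷ 4 ∷ 8 ∷ 8 ∷ 2 ∷ [])
                         (11 ∷ 0 ∷ 3 ∷ 8 ∷ 5 ∷ 8 ∷ 3 ∷ 12 ∷ 10 ∷ 7 ∷ 10 ∷ 12 ∷ 5 ∷ 5 ∷ 7 ∷ []))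
    ∷ (239085 , strategy (2 ∷ 1 ∷ 8 ∷ 4 ∷ 2 ∷ 4 ∷ 16 ∷ 1 ∷ 2 ∷ 1 ∷ 0 ∷ 1 ∷ 2 ∷ 2 ∷ 8 ∷ [])
                         (3 ∷ 0 ∷ 6 ∷ 2 ∷ 3 ∷ 2 ∷ 10 ∷ 12 ∷ 3 ∷ 8 ∷ 10 ∷ 0 ∷ 5 ∷ 5 ∷ 6 ∷ []))
    ∷ (3825360 , strategy (4 ∷ 8 ∷ 4 ∷ 2 ∷ 2 ∷ 2 ∷ 1 ∷ 4 ∷ 1 ∷ 2 ∷ 0 ∷ 1 ∷ 2 ∷ 4 ∷ 2 ∷ [])
                          (1 ∷ 10 ∷ 1 ∷ 13 ∷ 7 ∷ 2 ∷ 3 ∷ 1 ∷ 3 ∷ 7 ∷ 10 ∷ 12 ∷ 7 ∷ 1 ∷ 7 ∷ []))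
    ∷ (166320 , strategy (16 ∷ 2 ∷ 4 ∷ 8 ∷ 8 ∷ 2 ∷ 2 ∷ 1 ∷ 4 ∷ 2 ∷ 0 ∷ 32 ∷ 16 ∷ 1 ∷ 4 ∷ [])
                         (11 ∷ 2 ∷ 3 ∷ 0 ∷ 0 ∷ 8 ∷ 2 ∷ 1 ∷ 3 ∷ 8 ∷ 10 ∷ 10 ∷ 11 ∷ 1 ∷ 4 ∷ []))
    ∷ [])

certificate₁₁ : Certificate 15
certificate₁₁ =
  byStrategies 4320
    ( (105 , strategy (0 ∷ 8 ∷ 4 ∷ 1 ∷ 0 ∷ 2 ∷ 2 ∷ 4 ∷ 0 ∷ 0 ∷ 0 ∷ 0 ∷ 0 ∷ 2 ∷ 2 ∷ [])
                      (11 ∷ 11 ∷ 1 ∷ 6 ∷ 11 ∷ 2 ∷ 2 ∷ 1 ∷ 11 ∷ 11 ∷ 11 ∷ 11 ∷ 11 ∷ 7 ∷ 7 ∷ []))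
    ∷ (840 , strategy (0 ∷ 0 ∷ 1 ∷ 1 ∷ 2 ∷ 0 ∷ 2 ∷ 0 ∷ 2 ∷ 2 ∷ 4 ∷ 0 ∷ 0 ∷ 0 ∷ 2 ∷ [])
                      (11 ∷ 11 ∷ 6 ∷ 8 ∷ 10 ∷ 11 ∷ 10 ∷ 11 ∷ 10 ∷ 10 ∷ 11 ∷ 11 ∷ 11 ∷ 11 ∷ 10 ∷ []))
    ∷ (140 , strategy (0 ∷ 0 ∷ 0 ∷ 0 ∷ 0 ∷ 4 ∷ 1 ∷ 4 ∷ 2 ∷ 1 ∷ 0 ∷ 0 ∷ 8 ∷ 2 ∷ 2 ∷ [])
                      (11 ∷ 11 ∷ 11 ∷ 11 ∷ 11 ∷ 12 ∷ 14 ∷ 12 ∷ 5 ∷ 8 ∷ 11 ∷ 11 ∷ 11 ∷ 7 ∷ 7 ∷ []))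
    ∷ (210 , strategy (8 ∷ 0 ∷ 2 ∷ 4 ∷ 0 ∷ 4 ∷ 2 ∷ 0 ∷ 2 ∷ 1 ∷ 0 ∷ 0 ∷ 0 ∷ 2 ∷ 0 ∷ [])
                      (11 ∷ 11 ∷ 5 ∷ 0 ∷ 11 ∷ 0 ∷ 3 ∷ 11 ∷ 5 ∷ 8 ∷ 11 ∷ 11 ∷ 11 ∷ 5 ∷ 11 ∷ []))
    ∷ (840 , strategy (0 ∷ 0 ∷ 1 ∷ 0 ∷ 1 ∷ 2 ∷ 0 ∷ 2 ∷ 1 ∷ 1 ∷ 0 ∷ 0 ∷ 4 ∷ 1 ∷ 1 ∷ [])
                      (11 ∷ 11 ∷ 5 ∷ 11 ∷ 5 ∷ 12 ∷ 11 ∷ 12 ∷ 5 ∷ 7 ∷ 11 ∷ 11 ∷ 11 ∷ 5 ∷ 7 ∷ []))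
    ∷ (672 , strategy (0 ∷ 4 ∷ 2 ∷ 2 ∷ 0 ∷ 0 ∷ 1 ∷ 2 ∷ 0 ∷ 1 ∷ 0 ∷ 0 ∷ 0 ∷ 2 ∷ 1 ∷ [])
                      (11 ∷ 11 ∷ 1 ∷ 1 ∷ 11 ∷ 11 ∷ 2 ∷ 1 ∷ 11 ∷ 7 ∷ 11 ∷ 11 ∷ 11 ∷ 1 ∷ 7 ∷ []))
    ∷ (140 , strategy (0 ∷ 8 ∷ 0 ∷ 0 ∷ 1 ∷ 0 ∷ 1 ∷ 4 ∷ 0 ∷ 2 ∷ 0 ∷ 0 ∷ 0 ∷ 4 ∷ 2 ∷ [])
                      (11 ∷ 11 ∷ 11 ∷ 11 ∷ 14 ∷ 11 ∷ 14 ∷ 1 ∷ 11 ∷ 7 ∷ 11 ∷ 11 ∷ 11 ∷ 1 ∷ 7 ∷ []))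
    ∷ (240 , strategy (8 ∷ 0 ∷ 2 ∷ 4 ∷ 4 ∷ 4 ∷ 2 ∷ 0 ∷ 2 ∷ 1 ∷ 0 ∷ 0 ∷ 0 ∷ 2 ∷ 1 ∷ [])
                      (11 ∷ 11 ∷ 3 ∷ 0 ∷ 0 ∷ 0 ∷ 3 ∷ 11 ∷ 5 ∷ 8 ∷ 11 ∷ 11 ∷ 11 ∷ 3 ∷ 6 ∷ []))
    ∷ (105 , strategy (8 ∷ 0 ∷ 0 ∷ 4 ∷ 4 ∷ 0 ∷ 2 ∷ 0 ∷ 2 ∷ 1 ∷ 0 ∷ 0 ∷ 0 ∷ 2 ∷ 0 ∷ [])
                      (11 ∷ 11 ∷ 11 ∷ 0 ∷ 0 ∷ 11 ∷ 3 ∷ 11 ∷ 3 ∷ 8 ∷ 11 ∷ 11 ∷ 11 ∷ 3 ∷ 11 ∷ []))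
    ∷ (120 , strategy (0 ∷ 0 ∷ 2 ∷ 0 ∷ 4 ∷ 2 ∷ 4 ∷ 0 ∷ 4 ∷ 2 ∷ 8 ∷ 0 ∷ 0 ∷ 1 ∷ 2 ∷ [])
                      (11 ∷ 11 ∷ 6 ∷ 11 ∷ 10 ∷ 8 ∷ 10 ∷ 11 ∷ 10 ∷ 8 ∷ 11 ∷ 11 ∷ 11 ∷ 5 ∷ 4 ∷ []))
    ∷ [])

certificate₁₂ : Certificate 15
certificate₁₂ =
  byStrategies 790812
    ( (99792 , strategy (0 ∷ 2 ∷ 1 ∷ 1 ∷ 0 ∷ 0 ∷ 1 ∷ 4 ∷ 1 ∷ 2 ∷ 1 ∷ 0 ∷ 0 ∷ 2 ∷ 2 ∷ [])
                        (12 ∷ 7 ∷ 1 ∷ 1 ∷ 12 ∷ 12 ∷ 14 ∷ 12 ∷ 9 ∷ 7 ∷ 14 ∷ 12 ∷ 12 ∷ 7 ∷ 7 ∷ []))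
    ∷ (11088 , strategy (4 ∷ 2 ∷ 1 ∷ 2 ∷ 2 ∷ 0 ∷ 1 ∷ 0 ∷ 1 ∷ 0 ∷ 0 ∷ 0 ∷ 0 ∷ 1 ∷ 1 ∷ [])
                        (12 ∷ 0 ∷ 3 ∷ 0 ∷ 0 ∷ 12 ∷ 3 ∷ 12 ∷ 3 ∷ 12 ∷ 12 ∷ 12 ∷ 12 ∷ 3 ∷ 4 ∷ []))
    ∷ (16016 , strategy (0 ∷ 2 ∷ 1 ∷ 1 ∷ 2 ∷ 0 ∷ 1 ∷ 4 ∷ 0 ∷ 2 ∷ 0 ∷ 0 ∷ 0 ∷ 2 ∷ 2 ∷ [])
                        (12 ∷ 7 ∷ 1 ∷ 1 ∷ 7 ∷ 12 ∷ 14 ∷ 12 ∷ 12 ∷ 7 ∷ 12 ∷ 12 ∷ 12 ∷ 7 ∷ 7 ∷ []))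
    ∷ (51480 , strategy (4 ∷ 2 ∷ 1 ∷ 2 ∷ 2 ∷ 0 ∷ 1 ∷ 0 ∷ 1 ∷ 0 ∷ 1 ∷ 0 ∷ 0 ∷ 1 ∷ 1 ∷ [])
                        (12 ∷ 0 ∷ 3 ∷ 0 ∷ 0 ∷ 12 ∷ 3 ∷ 12 ∷ 3 ∷ 12 ∷ 1 ∷ 12 ∷ 12 ∷ 3 ∷ 4 ∷ []))
    ∷ (135135 , strategy (4 ∷ 2 ∷ 1 ∷ 2 ∷ 2 ∷ 0 ∷ 1 ∷ 0 ∷ 0 ∷ 0 ∷ 1 ∷ 0 ∷ 0 ∷ 1 ∷ 1 ∷ [])
                         (12 ∷ 0 ∷ 1 ∷ 0 ∷ 0 ∷ 12 ∷ 3 ∷ 12 ∷ 12 ∷ 12 ∷ 1 ∷ 12 ∷ 12 ∷ 1 ∷ 4 ∷ []))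
    ∷ (39312 , strategy (0 ∷ 0 ∷ 1 ∷ 2 ∷ 2 ∷ 0 ∷ 4 ∷ 0 ∷ 4 ∷ 4 ∷ 8 ∷ 16 ∷ 0 ∷ 0 ∷ 4 ∷ [])
                        (12 ∷ 12 ∷ 3 ∷ 8 ∷ 14 ∷ 12 ∷ 10 ∷ 12 ∷ 10 ∷ 10 ∷ 11 ∷ 12 ∷ 12 ∷ 12 ∷ 10 ∷ []))
    ∷ (144144 , strategy (0 ∷ 0 ∷ 2 ∷ 1 ∷ 2 ∷ 4 ∷ 1 ∷ 0 ∷ 2 ∷ 1 ∷ 0 ∷ 0 ∷ 0 ∷ 2 ∷ 0 ∷ [])
                         (12 ∷ 12 ∷ 5 ∷ 8 ∷ 5 ∷ 12 ∷ 2 ∷ 12 ∷ 5 ∷ 8 ∷ 12 ∷ 12 ∷ 12 ∷ 5 ∷ 12 ∷ []))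
    ∷ (9009 , strategy (0 ∷ 16 ∷ 1 ∷ 2 ∷ 0 ∷ 0 ∷ 8 ∷ 0 ∷ 4 ∷ 8 ∷ 16 ∷ 32 ∷ 0 ∷ 0 ∷ 8 ∷ [])
                       (12 ∷ 11 ∷ 3 ∷ 8 ∷ 12 ∷ 12 ∷ 10 ∷ 12 ∷ 9 ∷ 10 ∷ 11 ∷ 12 ∷ 12 ∷ 12 ∷ 10 ∷ []))
    ∷ (27027 , strategy (0 ∷ 0 ∷ 4 ∷ 1 ∷ 0 ∷ 8 ∷ 2 ∷ 0 ∷ 4 ∷ 2 ∷ 1 ∷ 0 ∷ 0 ∷ 0 ∷ 0 ∷ [])
                        (12 ∷ 12 ∷ 5 ∷ 6 ∷ 12 ∷ 12 ∷ 2 ∷ 12 ∷ 5 ∷ 8 ∷ 9 ∷ 12 ∷ 12 ∷ 12 ∷ 12 ∷ []))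
    ∷ (22176 , strategy (0 ∷ 0 ∷ 0 ∷ 1 ∷ 0 ∷ 0 ∷ 2 ∷ 8 ∷ 1 ∷ 4 ∷ 2 ∷ 0 ∷ 0 ∷ 0 ∷ 4 ∷ [])
                        (12 ∷ 12 ∷ 12 ∷ 6 ∷ 12 ∷ 12 ∷ 14 ∷ 12 ∷ 10 ∷ 7 ∷ 14 ∷ 12 ∷ 12 ∷ 12 ∷ 7 ∷ []))
    ∷ (39312 , strategy (0 ∷ 2 ∷ 1 ∷ 0 ∷ 0 ∷ 0 ∷ 1 ∷ 4 ∷ 1 ∷ 2 ∷ 1 ∷ 0 ∷ 0 ∷ 2 ∷ 2 ∷ [])
                        (12 ∷ 7 ∷ 1 ∷ 12 ∷ 12 ∷ 12 ∷ 14 ∷ 12 ∷ 9 ∷ 7 ∷ 9 ∷ 12 ∷ 12 ∷ 7 ∷ 7 ∷ []))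
    ∷ [])

certificate₁₃ : Certificate 15
certificate₁₃ =
  byStrategies 3434704
    ( (131040 , strategy (4 ∷ 0 ∷ 2 ∷ 8 ∷ 4 ∷ 0 ∷ 4 ∷ 0 ∷ 0 ∷ 1 ∷ 2 ∷ 2 ∷ 0 ∷ 0 ∷ 2 ∷ [])
                         (3 ∷ 13 ∷ 6 ∷ 13 ∷ 3 ∷ 13 ∷ 3 ∷ 13 ∷ 13 ∷ 10 ∷ 4 ∷ 0 ∷ 13 ∷ 13 ∷ 6 ∷ []))
    ∷ (45045 , strategy (0 ∷ 8 ∷ 0 ∷ 0 ∷ 0 ∷ 0 ∷ 1 ∷ 0 ∷ 2 ∷ 0 ∷ 4 ∷ 4 ∷ 2 ∷ 0 ∷ 2 ∷ [])
                        (13 ∷ 13 ∷ 13 ∷ 13 ∷ 13 ∷ 13 ∷ 14 ∷ 13 ∷ 10 ∷ 13 ∷ 1 ∷ 1 ∷ 11 ∷ 13 ∷ 10 ∷ []))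
    ∷ (110880 , strategy (0 ∷ 0 ∷ 0 ∷ 0 ∷ 0 ∷ 0 ∷ 1 ∷ 8 ∷ 1 ∷ 4 ∷ 2 ∷ 2 ∷ 4 ∷ 0 ∷ 0 ∷ [])
                         (13 ∷ 13 ∷ 13 ∷ 13 ∷ 13 ∷ 13 ∷ 10 ∷ 13 ∷ 10 ∷ 7 ∷ 9 ∷ 12 ∷ 7 ∷ 13 ∷ 13 ∷ []))
    ∷ (72072 , strategy (4 ∷ 2 ∷ 8 ∷ 2 ∷ 8 ∷ 16 ∷ 1 ∷ 2 ∷ 8 ∷ 4 ∷ 4 ∷ 4 ∷ 8 ∷ 0 ∷ 4 ∷ [])
                        (12 ∷ 11 ∷ 5 ∷ 0 ∷ 5 ∷ 13 ∷ 3 ∷ 9 ∷ 5 ∷ 8 ∷ 8 ∷ 12 ∷ 5 ∷ 13 ∷ 4 ∷ []))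
    ∷ (669240 , strategy (0 ∷ 0 ∷ 0 ∷ 0 ∷ 0 ∷ 0 ∷ 1 ∷ 4 ∷ 1 ∷ 2 ∷ 0 ∷ 1 ∷ 2 ∷ 0 ∷ 2 ∷ [])
                         (13 ∷ 13 ∷ 13 ∷ 13 ∷ 13 ∷ 13 ∷ 14 ∷ 13 ∷ 9 ∷ 7 ∷ 13 ∷ 12 ∷ 7 ∷ 13 ∷ 7 ∷ []))
    ∷ (45045 , strategy (0 ∷ 0 ∷ 0 ∷ 0 ∷ 0 ∷ 16 ∷ 1 ∷ 0 ∷ 8 ∷ 4 ∷ 2 ∷ 1 ∷ 8 ∷ 0 ∷ 0 ∷ [])
                        (13 ∷ 13 ∷ 13 ∷ 13 ∷ 13 ∷ 13 ∷ 10 ∷ 13 ∷ 5 ∷ 8 ∷ 9 ∷ 10 ∷ 5 ∷ 13 ∷ 13 ∷ []))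
    ∷ (720720 , strategy (2 ∷ 4 ∷ 2 ∷ 0 ∷ 1 ∷ 0 ∷ 1 ∷ 0 ∷ 0 ∷ 1 ∷ 2 ∷ 2 ∷ 0 ∷ 0 ∷ 1 ∷ [])
                         (1 ∷ 13 ∷ 1 ∷ 13 ∷ 10 ∷ 13 ∷ 10 ∷ 13 ∷ 13 ∷ 10 ∷ 1 ∷ 1 ∷ 13 ∷ 13 ∷ 10 ∷ []))
    ∷ (45045 , strategy (4 ∷ 0 ∷ 4 ∷ 0 ∷ 4 ∷ 8 ∷ 1 ∷ 0 ∷ 0 ∷ 0 ∷ 2 ∷ 0 ∷ 0 ∷ 0 ∷ 2 ∷ [])
                        (5 ∷ 13 ∷ 5 ∷ 13 ∷ 5 ∷ 13 ∷ 10 ∷ 13 ∷ 13 ∷ 13 ∷ 4 ∷ 13 ∷ 13 ∷ 13 ∷ 4 ∷ []))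
    ∷ (240240 , strategy (4 ∷ 0 ∷ 4 ∷ 8 ∷ 4 ∷ 0 ∷ 4 ∷ 0 ∷ 4 ∷ 2 ∷ 2 ∷ 1 ∷ 0 ∷ 0 ∷ 2 ∷ [])
                         (3 ∷ 13 ∷ 3 ∷ 13 ∷ 3 ∷ 13 ∷ 3 ∷ 13 ∷ 3 ∷ 8 ∷ 6 ∷ 10 ∷ 13 ∷ 13 ∷ 6 ∷ []))
    ∷ (90090 , strategy (2 ∷ 4 ∷ 2 ∷ 0 ∷ 0 ∷ 0 ∷ 1 ∷ 0 ∷ 1 ∷ 0 ∷ 2 ∷ 2 ∷ 1 ∷ 0 ∷ 0 ∷ [])
                        (1 ∷ 13 ∷ 1 ∷ 13 ∷ 13 ∷ 13 ∷ 2 ∷ 13 ∷ 10 ∷ 13 ∷ 1 ∷ 1 ∷ 0 ∷ 13 ∷ 13 ∷ []))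
    ∷ (80080 , strategy (2 ∷ 0 ∷ 1 ∷ 4 ∷ 0 ∷ 0 ∷ 2 ∷ 0 ∷ 2 ∷ 1 ∷ 1 ∷ 0 ∷ 0 ∷ 0 ∷ 1 ∷ [])
                        (3 ∷ 13 ∷ 6 ∷ 13 ∷ 13 ∷ 13 ∷ 3 ∷ 13 ∷ 3 ∷ 8 ∷ 8 ∷ 13 ∷ 13 ∷ 13 ∷ 6 ∷ []))
    ∷ (166320 , strategy (0 ∷ 0 ∷ 0 ∷ 0 ∷ 4 ∷ 8 ∷ 1 ∷ 0 ∷ 4 ∷ 0 ∷ 2 ∷ 1 ∷ 4 ∷ 0 ∷ 2 ∷ [])
                         (13 ∷ 13 ∷ 13 ∷ 13 ∷ 5 ∷ 13 ∷ 14 ∷ 13 ∷ 5 ∷ 13 ∷ 4 ∷ 10 ∷ 5 ∷ 13 ∷ 4 ∷ []))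
    ∷ [])

certificate₁₄ : Certificate 15
certificate₁₄ =
  byStrategies 3344
    ( (99 , strategy (0 ∷ 2 ∷ 1 ∷ 0 ∷ 0 ∷ 0 ∷ 0 ∷ 4 ∷ 0 ∷ 2 ∷ 0 ∷ 1 ∷ 2 ∷ 2 ∷ 0 ∷ [])
                     (14 ∷ 7 ∷ 1 ∷ 14 ∷ 14 ∷ 14 ∷ 14 ∷ 14 ∷ 14 ∷ 7 ∷ 14 ∷ 12 ∷ 7 ∷ 7 ∷ 14 ∷ []))
    ∷ (66 , strategy (0 ∷ 4 ∷ 8 ∷ 0 ∷ 0 ∷ 4 ∷ 16 ∷ 0 ∷ 2 ∷ 1 ∷ 0 ∷ 2 ∷ 0 ∷ 0 ∷ 0 ∷ [])
                     (14 ∷ 2 ∷ 6 ∷ 14 ∷ 14 ∷ 2 ∷ 14 ∷ 14 ∷ 5 ∷ 8 ∷ 14 ∷ 1 ∷ 14 ∷ 14 ∷ 14 ∷ []))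
    ∷ (288 , strategy (2 ∷ 0 ∷ 4 ∷ 4 ∷ 0 ∷ 2 ∷ 8 ∷ 0 ∷ 2 ∷ 0 ∷ 0 ∷ 0 ∷ 1 ∷ 2 ∷ 0 ∷ [])
                      (3 ∷ 14 ∷ 6 ∷ 6 ∷ 14 ∷ 2 ∷ 14 ∷ 14 ∷ 3 ∷ 14 ∷ 14 ∷ 14 ∷ 0 ∷ 3 ∷ 14 ∷ []))
    ∷ (528 , strategy (1 ∷ 2 ∷ 0 ∷ 0 ∷ 0 ∷ 1 ∷ 0 ∷ 4 ∷ 1 ∷ 2 ∷ 0 ∷ 1 ∷ 2 ∷ 2 ∷ 0 ∷ [])
                      (12 ∷ 7 ∷ 14 ∷ 14 ∷ 14 ∷ 12 ∷ 14 ∷ 14 ∷ 9 ∷ 7 ∷ 14 ∷ 12 ∷ 7 ∷ 7 ∷ 14 ∷ []))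
    ∷ (198 , strategy (1 ∷ 2 ∷ 1 ∷ 0 ∷ 0 ∷ 0 ∷ 0 ∷ 0 ∷ 0 ∷ 2 ∷ 4 ∷ 2 ∷ 0 ∷ 1 ∷ 0 ∷ [])
                      (11 ∷ 10 ∷ 1 ∷ 14 ∷ 14 ∷ 14 ∷ 14 ∷ 14 ∷ 14 ∷ 10 ∷ 14 ∷ 10 ∷ 14 ∷ 1 ∷ 14 ∷ []))
    ∷ (88 , strategy (4 ∷ 16 ∷ 8 ∷ 8 ∷ 2 ∷ 4 ∷ 4 ∷ 1 ∷ 16 ∷ 16 ∷ 32 ∷ 16 ∷ 8 ∷ 4 ∷ 0 ∷ [])
                     (3 ∷ 10 ∷ 1 ∷ 8 ∷ 0 ∷ 2 ∷ 2 ∷ 4 ∷ 10 ∷ 10 ∷ 14 ∷ 10 ∷ 11 ∷ 3 ∷ 14 ∷ []))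
    ∷ (132 , strategy (1 ∷ 2 ∷ 1 ∷ 0 ∷ 0 ∷ 1 ∷ 0 ∷ 4 ∷ 0 ∷ 2 ∷ 0 ∷ 1 ∷ 2 ∷ 2 ∷ 0 ∷ [])
                      (12 ∷ 7 ∷ 1 ∷ 14 ∷ 14 ∷ 12 ∷ 14 ∷ 14 ∷ 14 ∷ 7 ∷ 14 ∷ 12 ∷ 7 ∷ 7 ∷ 14 ∷ []))
    ∷ (792 , strategy (2 ∷ 0 ∷ 1 ∷ 2 ∷ 4 ∷ 2 ∷ 0 ∷ 0 ∷ 1 ∷ 0 ∷ 0 ∷ 1 ∷ 1 ∷ 1 ∷ 0 ∷ [])
                      (4 ∷ 14 ∷ 5 ∷ 4 ∷ 14 ∷ 4 ∷ 14 ∷ 14 ∷ 5 ∷ 14 ∷ 14 ∷ 0 ∷ 5 ∷ 5 ∷ 14 ∷ []))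
    ∷ (66 , strategy (2 ∷ 1 ∷ 0 ∷ 0 ∷ 0 ∷ 2 ∷ 0 ∷ 8 ∷ 2 ∷ 4 ∷ 0 ∷ 2 ∷ 4 ∷ 1 ∷ 0 ∷ [])
                     (12 ∷ 0 ∷ 14 ∷ 14 ∷ 14 ∷ 12 ∷ 14 ∷ 14 ∷ 9 ∷ 7 ∷ 14 ∷ 12 ∷ 7 ∷ 5 ∷ 14 ∷ []))
    ∷ [])

certificate : Fin 15 → Certificate 15
certificate = Vec.lookup
  ( certificate₀ ∷ certificate₁ ∷ certificate₂ ∷ certificate₃ ∷ certificate₄ ∷ certificate₅ ∷ certificate₆
  ∷ certificate₇ ∷ certificate₈ ∷ certificate₉ ∷ certificate₁₀ ∷ certificate₁₁ ∷ certificate₁₂ ∷ certificate₁₃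
  ∷ certificate₁₄ ∷ [])

certificates-valid : ∀ r → Certification.Valid R15 r 15 (emptyAt r) (certificate r)
certificates-valid = toWitness {a? = all? λ r → Certification.valid? R15 r 15 adj? (emptyAt r) (certificate r)} tt

theorem3p7 : Class0 R15
theorem3p7 = AllSolvable⇒Class0 R15 fzero λ r →
  Certification.AllSolvable-certified R15 r 15 (certificate r) (certificates-valid r)
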